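{- Let $n\geq 4$ and let $\mathcal{L}$ be a Cameron-Liebler line class of parameter $x$ in $\mathrm{AG}(n,q)$. Then $x\in\{0,1\}$ or $$x\geq 2\left( \frac{q^{n-1}-1}{q^{2}-1}\right) +1.$$
   Context: For an affine space $\mathrm{AG}(n,q)$, a Cameron-Liebler line class is a set $\mathcal{L}$ of lines whose characteristic vector lies in the row space (over the reals) of the point-line incidence matrix of $\mathrm{AG}(n,q)$; its parameter $x$ is defined by $|\mathcal{L}|=x\frac{q^n-1}{q-1}$. -}

module Defs where

open import Level using (0ℓ)
open import Data.Nat as ℕ using (ℕ; zero; suc)
open import Data.Fin using (Fin)
open import Data.List using (List; []; _∷_; map; concatMap; foldr; length; allFin)
open import Data.List.Relation.Unary.All using (All)
open import Data.List.Relation.Unary.Any using (Any)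
open import Data.List.Relation.Unary.AllPairs using (AllPairs)
open import Data.List.Membership.Propositional using (_∈_)
open import Data.Vec using (Vec; []; _∷_; zipWith; replicate) renaming (map to vmap)
open import Data.Bool using (Bool; true; false; if_then_else_)
open import Data.Product using (Σ; ∃; _×_; _,_)
open import Data.Rational as ℚ using (ℚ)
import Data.Integer as ℤ
open import Relation.Binary.PropositionalEquality using (_≡_; _≢_)
open import Relation.Nullary using (¬_)

open import Algebra.Structures using (IsCommutativeRing)
open import Function.Bundles using (_↔_; Inverse)


record FiniteField (q : ℕ) : Set₁ where
  field
    Carrier : Set
    _+_ _*_ : Carrier → Carrier → Carrier
    -_ : Carrier → Carrier
    0# 1# : Carrier
    isCommutativeRing : IsCommutativeRing _≡_ _+_ _*_ -_ 0# 1#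
    0≢1 : 0# ≢ 1#
    inverse : ∀ x → x ≢ 0# → Σ Carrier λ y → x * y ≡ 1#
    enum : Fin q ↔ Carrier

module AG {q : ℕ} (𝔽 : FiniteField q) (n : ℕ) where
  open FiniteField 𝔽

  Point : Set
  Point = Vec Carrier n

  elements : List Carrier
  elements = map (Inverse.to enum) (allFin q)

  allVecs : (m : ℕ) → List (Vec Carrier m)
  allVecs zero = [] ∷ []
  allVecs (suc m) = concatMap (λ a → map (a ∷_) (allVecs m)) elements

  points : List Point
  points = allVecs n

  zeroV : Point
  zeroV = replicate n 0#

  _⊕_ : Point → Point → Point
  _⊕_ = zipWith _+_

  _·_ : Carrier → Point → Point
  t · v = vmap (t *_) v

  PointSet : Set
  PointSet = Point → Bool

  IsLine : PointSet → Set
  IsLine ℓ = Σ Point λ a → Σ Point λ d → (d ≢ zeroV) ×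
    (∀ p → (ℓ p ≡ true → Σ Carrier λ t → p ≡ a ⊕ (t · d))
         × ((Σ Carrier λ t → p ≡ a ⊕ (t · d)) → ℓ p ≡ true))

  _≐_ : PointSet → PointSet → Set
  ℓ ≐ m = ∀ p → ℓ p ≡ m p

  record LineSet : Set where
    field
      lines    : List PointSet
      allLines : All IsLine lines
      distinct : AllPairs (λ ℓ m → ¬ (ℓ ≐ m)) lines

  _∈ᴸ_ : PointSet → LineSet → Set
  ℓ ∈ᴸ 𝓛 = Any (λ m → ℓ ≐ m) (LineSet.lines 𝓛)

  size : LineSet → ℕ
  size 𝓛 = length (LineSet.lines 𝓛)

  sumOn : (Point → ℚ) → PointSet → ℚ
  sumOn c ℓ = foldr (λ p s → (if ℓ p then c p else ℚ.0ℚ) ℚ.+ s) ℚ.0ℚ points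

  -- The characteristic vector of 𝓛 (indexed by lines) lies in the row space of
  -- the point-line incidence matrix: it equals ∑_p c_p · (row of p), i.e.
  -- for every line ℓ, χ_𝓛(ℓ) = ∑_{p ∈ ℓ} c_p.
  IsCameronLiebler : LineSet → Set
  IsCameronLiebler 𝓛 = Σ (Point → ℚ) λ c → ∀ ℓ → IsLine ℓ →
    (ℓ ∈ᴸ 𝓛 → sumOn c ℓ ≡ ℚ.1ℚ) × (¬ (ℓ ∈ᴸ 𝓛) → sumOn c ℓ ≡ ℚ.0ℚ)

-- the rational number a / b (b > 0 in all uses; b = 0 gives 0 by convention)
frac : ℕ → ℕ → ℚ
frac a zero = ℚ.0ℚ
frac a (suc b) = ℤ.+ a ℚ./ suc b

ℕtoℚ : ℕ → ℚ
ℕtoℚ a = ℤ.+ a ℚ./ 1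

{-# OPTIONS --safe #-}

-- Let c be the point weights with χ_𝓛(ℓ) = Σ_{p ∈ ℓ} c(p), and S = Σ_p c(p). Counting the pairs
-- (p, d) with d ≠ 0 and line(p, d) ∈ 𝓛 in two ways gives |𝓛|(q − 1) = (qⁿ − 1) S, so x = S. The same
-- count at a single point p (its pencil sum) equals q K c(p) + (q − 1) S with K = q^(n−1) − 1 and is
-- nonnegative, while comparing the lines through p in a plane with a parallel class of that plane
-- shows that q c(p) is an integer.
-- If x < 2K/(q² − 1) + 1 then K > (q − 1) S, and these facts force c ≥ 0. Every line through a point
-- of positive weight then lies in 𝓛, which pins all positive weights to one value γ with
-- q K (1 − γ) = (q − 1)(S − 1). Unless S ∈ {0, 1}, a line of 𝓛 through a point of positive weight
-- contains a second one, so γ ≤ 1/2; with K > (q − 1) S this is impossible.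

module Submission where

open import Algebra.Bundles using (CommutativeRing)
import Algebra.Properties.Semiring.Mult as SemiringMult
open import Algebra.Structures using (IsCommutativeRing)
open import Data.Bool as Bool using (Bool; true; false; if_then_else_)
open import Data.Bool.Properties using (⇔→≡)
open import Data.Empty using (⊥; ⊥-elim)
open import Data.Fin as Fin using (Fin)
import Data.Fin.Properties as Fin
import Data.Integer as ℤ
import Data.Integer.Properties as ℤ
open import Data.List using (List; []; _∷_; map; concatMap; length; foldr; _++_; allFin; tabulate)
import Data.List.Properties as List
open import Data.List.Membership.Propositional using (_∈_)
open import Data.List.Relation.Unary.All as All using (All; []; _∷_)
open import Data.List.Relation.Unary.All.Properties using (All¬⇒¬Any)
open import Data.List.Relation.Unary.AllPairs using (AllPairs; []; _∷_)
open import Data.List.Relation.Unary.Any as Any using (Any; here; there; any?)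
open import Data.Nat as ℕ using (ℕ; zero; suc)
import Data.Nat.Properties as ℕ
open import Data.Product using (∃; _×_; _,_; proj₁; proj₂)
open import Data.Rational using (ℚ; 0ℚ; 1ℚ; _+_; _*_; -_; _-_; _≤_; _<_; toℚᵘ; positive; nonNegative)
open import Data.Rational.Properties
import Data.Rational.Unnormalised as ℚᵘ
import Data.Rational.Unnormalised.Properties as ℚᵘ
open import Data.Sum as Sum using (_⊎_; inj₁; inj₂)
open import Data.Vec as Vec using (Vec; []; _∷_; zipWith; replicate)
import Data.Vec.Properties as Vec
open import Function using (_∘_; id; mk⇔)
open import Function.Bundles using (Inverse; Injection)
open import Function.Properties.Inverse using (↔-sym; ↔⇒↣)
open import Relation.Binary.Definitions using (DecidableEquality)
open import Relation.Binary.PropositionalEquality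
open import Relation.Nullary using (¬_; Dec; yes; no; does; ¬?; _×-dec_)
open import Relation.Nullary.Decidable using (dec⇒maybe; dec-true; map′)
open import Tactic.RingSolver using (solve-∀)
open import Tactic.RingSolver.Core.AlmostCommutativeRing using (AlmostCommutativeRing; fromCommutativeRing)

open import Defs

ℚ-ring : AlmostCommutativeRing _ _
ℚ-ring = fromCommutativeRing +-*-commutativeRing (λ x → dec⇒maybe (0ℚ ≟ x))

toℚᵘ-ℕtoℚ : ∀ k → toℚᵘ (ℕtoℚ k) ℚᵘ.≃ ℚᵘ.mkℚᵘ (ℤ.+ k) 0
toℚᵘ-ℕtoℚ k = toℚᵘ-fromℚᵘ (ℚᵘ.mkℚᵘ (ℤ.+ k) 0)

ℕtoℚ-suc : ∀ k → ℕtoℚ (suc k) ≡ 1ℚ + ℕtoℚ k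
ℕtoℚ-suc k = toℚᵘ-injective (begin
  toℚᵘ (ℕtoℚ (suc k))           ≈⟨ toℚᵘ-ℕtoℚ (suc k) ⟩
  ℚᵘ.mkℚᵘ (ℤ.+ suc k) 0          ≈⟨ ℚᵘ.*≡* (trans (ℤ.*-identityʳ _) (sym (trans (ℤ.*-identityʳ _)
                                      (cong (ℤ._+_ ℤ.1ℤ) (ℤ.*-identityʳ (ℤ.+ k)))))) ⟩
  ℚᵘ.1ℚᵘ ℚᵘ.+ ℚᵘ.mkℚᵘ (ℤ.+ k) 0  ≈⟨ ℚᵘ.+-congʳ ℚᵘ.1ℚᵘ (ℚᵘ.≃-sym (toℚᵘ-ℕtoℚ k)) ⟩
  toℚᵘ 1ℚ ℚᵘ.+ toℚᵘ (ℕtoℚ k)     ≈⟨ ℚᵘ.≃-sym (toℚᵘ-homo-+ 1ℚ (ℕtoℚ k)) ⟩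
  toℚᵘ (1ℚ + ℕtoℚ k)             ∎)
  where open import Relation.Binary.Reasoning.Setoid ℚᵘ.≃-setoid

open SemiringMult (CommutativeRing.semiring +-*-commutativeRing) using (×-homo-+; ×1-homo-*) renaming (_×_ to _×ℚ_)

ℕtoℚ≡×1 : ∀ k → ℕtoℚ k ≡ k ×ℚ 1ℚ
ℕtoℚ≡×1 zero    = refl
ℕtoℚ≡×1 (suc k) = trans (ℕtoℚ-suc k) (cong (1ℚ +_) (ℕtoℚ≡×1 k))

ℕtoℚ-+ : ∀ m n → ℕtoℚ (m ℕ.+ n) ≡ ℕtoℚ m + ℕtoℚ n
ℕtoℚ-+ m n = begin
  ℕtoℚ (m ℕ.+ n)        ≡⟨ ℕtoℚ≡×1 (m ℕ.+ n) ⟩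
  (m ℕ.+ n) ×ℚ 1ℚ        ≡⟨ ×-homo-+ 1ℚ m n ⟩
  m ×ℚ 1ℚ + n ×ℚ 1ℚ       ≡⟨ sym (cong₂ _+_ (ℕtoℚ≡×1 m) (ℕtoℚ≡×1 n)) ⟩
  ℕtoℚ m + ℕtoℚ n       ∎
  where open ≡-Reasoning

ℕtoℚ-* : ∀ m n → ℕtoℚ (m ℕ.* n) ≡ ℕtoℚ m * ℕtoℚ n
ℕtoℚ-* m n = begin
  ℕtoℚ (m ℕ.* n)        ≡⟨ ℕtoℚ≡×1 (m ℕ.* n) ⟩
  (m ℕ.* n) ×ℚ 1ℚ        ≡⟨ ×1-homo-* m n ⟩
  m ×ℚ 1ℚ * n ×ℚ 1ℚ       ≡⟨ sym (cong₂ _*_ (ℕtoℚ≡×1 m) (ℕtoℚ≡×1 n)) ⟩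
  ℕtoℚ m * ℕtoℚ n       ∎
  where open ≡-Reasoning

ℕtoℚ-∸ : ∀ m n → n ℕ.≤ m → ℕtoℚ (m ℕ.∸ n) ≡ ℕtoℚ m - ℕtoℚ n
ℕtoℚ-∸ m n n≤m = begin
  ℕtoℚ (m ℕ.∸ n)                     ≡⟨ add-sub (ℕtoℚ (m ℕ.∸ n)) (ℕtoℚ n) ⟩
  ℕtoℚ (m ℕ.∸ n) + ℕtoℚ n - ℕtoℚ n   ≡⟨ cong (_- ℕtoℚ n) (sym (ℕtoℚ-+ (m ℕ.∸ n) n)) ⟩
  ℕtoℚ (m ℕ.∸ n ℕ.+ n) - ℕtoℚ n      ≡⟨ cong (λ k → ℕtoℚ k - ℕtoℚ n) (ℕ.m∸n+n≡m n≤m) ⟩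
  ℕtoℚ m - ℕtoℚ n                    ∎
  where
  open ≡-Reasoning
  add-sub : ∀ a b → a ≡ a + b - b
  add-sub = solve-∀ ℚ-ring

ℕtoℚ-nonNeg : ∀ k → 0ℚ ≤ ℕtoℚ k
ℕtoℚ-nonNeg k = nonNegative⁻¹ _ {{normalize-nonNeg k 1}}

ℕtoℚ-mono-≤ : ∀ {m n} → m ℕ.≤ n → ℕtoℚ m ≤ ℕtoℚ n
ℕtoℚ-mono-≤ {m} {n} m≤n = begin
  ℕtoℚ m                     ≡⟨ sym (+-identityʳ (ℕtoℚ m)) ⟩
  ℕtoℚ m + 0ℚ                ≤⟨ +-monoʳ-≤ (ℕtoℚ m) (ℕtoℚ-nonNeg (n ℕ.∸ m)) ⟩
  ℕtoℚ m + ℕtoℚ (n ℕ.∸ m)    ≡⟨ sym (ℕtoℚ-+ m (n ℕ.∸ m)) ⟩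
  ℕtoℚ (m ℕ.+ (n ℕ.∸ m))     ≡⟨ cong ℕtoℚ (ℕ.m+[n∸m]≡n m≤n) ⟩
  ℕtoℚ n                     ∎
  where open ≤-Reasoning

ℕtoℚ-mono-< : ∀ {m n} → m ℕ.< n → ℕtoℚ m < ℕtoℚ n
ℕtoℚ-mono-< {m} {n} m<n = begin-strict
  ℕtoℚ m          ≡⟨ sym (+-identityˡ (ℕtoℚ m)) ⟩
  0ℚ + ℕtoℚ m     <⟨ +-monoˡ-< (ℕtoℚ m) (positive⁻¹ 1ℚ) ⟩
  1ℚ + ℕtoℚ m     ≡⟨ sym (ℕtoℚ-suc m) ⟩
  ℕtoℚ (suc m)    ≤⟨ ℕtoℚ-mono-≤ m<n ⟩
  ℕtoℚ n          ∎
  where open ≤-Reasoning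

frac-*-denominator : ∀ a m → 1 ℕ.≤ m → frac a m * ℕtoℚ m ≡ ℕtoℚ a
frac-*-denominator a (suc b) _ = toℚᵘ-injective (begin
  toℚᵘ (frac a (suc b) * ℕtoℚ (suc b))                      ≈⟨ toℚᵘ-homo-* (frac a (suc b)) (ℕtoℚ (suc b)) ⟩
  toℚᵘ (frac a (suc b)) ℚᵘ.* toℚᵘ (ℕtoℚ (suc b))            ≈⟨ ℚᵘ.*-cong (toℚᵘ-fromℚᵘ (ℚᵘ.mkℚᵘ (ℤ.+ a) b)) (toℚᵘ-ℕtoℚ (suc b)) ⟩
  ℚᵘ.mkℚᵘ (ℤ.+ a) b ℚᵘ.* ℚᵘ.mkℚᵘ (ℤ.+ suc b) 0             ≈⟨ ℚᵘ.*≡* (trans (ℤ.*-identityʳ _) (cong (λ m → ℤ.+ a ℤ.* ℤ.+ m) (sym (ℕ.*-identityʳ (suc b))))) ⟩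
  ℚᵘ.mkℚᵘ (ℤ.+ a) 0                                         ≈⟨ ℚᵘ.≃-sym (toℚᵘ-ℕtoℚ a) ⟩
  toℚᵘ (ℕtoℚ a)                                             ∎)
  where open import Relation.Binary.Reasoning.Setoid ℚᵘ.≃-setoid

module _ {a b : ℚ} where

  0≤* : 0ℚ ≤ a → 0ℚ ≤ b → 0ℚ ≤ a * b
  0≤* a≥0 b≥0 = nonNegative⁻¹ (a * b) {{nonNeg*nonNeg⇒nonNeg a {{nonNegative a≥0}} b {{nonNegative b≥0}}}}

  0<* : 0ℚ < a → 0ℚ < b → 0ℚ < a * b
  0<* a>0 b>0 = positive⁻¹ (a * b) {{pos*pos⇒pos a {{positive a>0}} b {{positive b>0}}}}

  0<*-cancelˡ : 0ℚ < a → 0ℚ < a * b → 0ℚ < b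
  0<*-cancelˡ a>0 ab>0 = *-cancelˡ-<-nonNeg a {{nonNegative (<⇒≤ a>0)}} (subst (_< a * b) (sym (*-zeroʳ a)) ab>0)

  0≤*-cancelˡ : 0ℚ < a → 0ℚ ≤ a * b → 0ℚ ≤ b
  0≤*-cancelˡ a>0 ab≥0 = *-cancelˡ-≤-pos a {{positive a>0}} (subst (_≤ a * b) (sym (*-zeroʳ a)) ab≥0)

  ≤⇒0≤- : a ≤ b → 0ℚ ≤ b - a
  ≤⇒0≤- a≤b = subst (_≤ b - a) (+-inverseʳ a) (+-monoˡ-≤ (- a) a≤b)

  <⇒0<- : a < b → 0ℚ < b - a
  <⇒0<- a<b = subst (_< b - a) (+-inverseʳ a) (+-monoˡ-< (- a) a<b)

  0<-⇒< : 0ℚ < b - a → a < b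
  0<-⇒< b-a>0 = subst₂ _<_ (+-identityʳ a) (a+[b-a]≡b a b) (+-monoʳ-< a b-a>0)
    where
    a+[b-a]≡b : ∀ a b → a + (b - a) ≡ b
    a+[b-a]≡b = solve-∀ ℚ-ring

*-cancelˡ-≡-pos : ∀ {a x y} → 0ℚ < a → a * x ≡ a * y → x ≡ y
*-cancelˡ-≡-pos {a} a>0 ax≡ay = ≤-antisym (*-cancelˡ-≤-pos a {{positive a>0}} (≤-reflexive ax≡ay))
                                          (*-cancelˡ-≤-pos a {{positive a>0}} (≤-reflexive (sym ax≡ay)))

nonNeg∧≢0⇒pos : ∀ {x} → 0ℚ ≤ x → x ≢ 0ℚ → 0ℚ < x
nonNeg∧≢0⇒pos {x} x≥0 x≢0 with 0ℚ <? x
... | yes x>0 = x>0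
... | no  x≯0 = ⊥-elim (x≢0 (≤-antisym (≮⇒≥ x≯0) x≥0))

01⇒nonNeg : ∀ {x} → x ≡ 0ℚ ⊎ x ≡ 1ℚ → 0ℚ ≤ x
01⇒nonNeg (inj₁ refl) = ≤-refl
01⇒nonNeg (inj₂ refl) = nonNegative⁻¹ 1ℚ

01⇒ℕ : ∀ {x} → x ≡ 0ℚ ⊎ x ≡ 1ℚ → ∃ λ k → x ≡ ℕtoℚ k
01⇒ℕ (inj₁ x≡0) = 0 , x≡0
01⇒ℕ (inj₂ x≡1) = 1 , x≡1

x≡y+z⇒z≡x-y : ∀ {x y z} → x ≡ y + z → z ≡ x - y
x≡y+z⇒z≡x-y {y = y} {z} refl = sym (y+z-y≡z y z)
  where
  y+z-y≡z : ∀ y z → y + z - y ≡ z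
  y+z-y≡z = solve-∀ ℚ-ring

x-1≡0⇒x≡1 : ∀ {x} → x - 1ℚ ≡ 0ℚ → x ≡ 1ℚ
x-1≡0⇒x≡1 {x} x-1≡0 = trans (shift x) (trans (cong (_+ 1ℚ) x-1≡0) (+-identityˡ 1ℚ))
  where
  shift : ∀ x → x ≡ x - 1ℚ + 1ℚ
  shift = solve-∀ ℚ-ring

1-x≡1-y⇒x≡y : ∀ {x y} → 1ℚ - x ≡ 1ℚ - y → x ≡ y
1-x≡1-y⇒x≡y {x} {y} eq = trans (involution x) (trans (cong (_-_ 1ℚ) eq) (sym (involution y)))
  where
  involution : ∀ x → x ≡ 1ℚ - (1ℚ - x)
  involution = solve-∀ ℚ-ring

a*γ+b*s≡a+b⇒a*[1-γ]≡b*[s-1] : ∀ {a b γ s} → a * γ + b * s ≡ a + b → a * (1ℚ - γ) ≡ b * (s - 1ℚ)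
a*γ+b*s≡a+b⇒a*[1-γ]≡b*[s-1] {a} {b} {γ} {s} eq = begin
  a * (1ℚ - γ)                                   ≡⟨ expand a b γ s ⟩
  (a + b) - (a * γ + b * s) + b * (s - 1ℚ)       ≡⟨ cong (λ x → x - (a * γ + b * s) + b * (s - 1ℚ)) (sym eq) ⟩
  (a * γ + b * s) - (a * γ + b * s) + b * (s - 1ℚ) ≡⟨ cong (_+ b * (s - 1ℚ)) (+-inverseʳ (a * γ + b * s)) ⟩
  0ℚ + b * (s - 1ℚ)                              ≡⟨ +-identityˡ _ ⟩
  b * (s - 1ℚ)                                   ∎
  where
  open ≡-Reasoning
  expand : ∀ a b γ s → a * (1ℚ - γ) ≡ (a + b) - (a * γ + b * s) + b * (s - 1ℚ)
  expand = solve-∀ ℚ-ring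

ℕ-difference>-1⇒nonNeg : ∀ {v} a b → v ≡ ℕtoℚ a - ℕtoℚ b → 0ℚ < v + 1ℚ → 0ℚ ≤ v
ℕ-difference>-1⇒nonNeg a b refl v+1>0 with b ℕ.≤? a
... | yes b≤a = ≤⇒0≤- (ℕtoℚ-mono-≤ b≤a)
... | no  b≰a = ⊥-elim (<-irrefl refl (<-≤-trans v+1>0 v+1≤0))
  where
  1+a≤b : 1ℚ + ℕtoℚ a ≤ ℕtoℚ b
  1+a≤b = subst (_≤ ℕtoℚ b) (ℕtoℚ-suc a) (ℕtoℚ-mono-≤ (ℕ.≰⇒> b≰a))
  v+1≤0 : ℕtoℚ a - ℕtoℚ b + 1ℚ ≤ 0ℚ
  v+1≤0 = subst₂ _≤_ (rearrange (ℕtoℚ a) (ℕtoℚ b)) (+-inverseʳ (ℕtoℚ b)) (+-monoˡ-≤ (- ℕtoℚ b) 1+a≤b)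
    where
    rearrange : ∀ a b → 1ℚ + a - b ≡ a - b + 1ℚ
    rearrange = solve-∀ ℚ-ring

∑ : {A : Set} → List A → (A → ℚ) → ℚ
∑ []       f = 0ℚ
∑ (x ∷ xs) f = f x + ∑ xs f

syntax ∑ xs (λ x → e) = ∑[ x ∈ xs ] e

module _ {A : Set} where

  ∑-cong : ∀ xs {f g : A → ℚ} → (∀ a → f a ≡ g a) → ∑ xs f ≡ ∑ xs g
  ∑-cong []       f≗g = refl
  ∑-cong (x ∷ xs) f≗g = cong₂ _+_ (f≗g x) (∑-cong xs f≗g)

  ∑-zero : ∀ xs (f : A → ℚ) → (∀ a → f a ≡ 0ℚ) → ∑ xs f ≡ 0ℚ
  ∑-zero []       f f≗0 = refl
  ∑-zero (x ∷ xs) f f≗0 = cong₂ _+_ (f≗0 x) (∑-zero xs f f≗0)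

  ∑-+ : ∀ xs (f g : A → ℚ) → ∑[ a ∈ xs ] (f a + g a) ≡ ∑ xs f + ∑ xs g
  ∑-+ []       f g = refl
  ∑-+ (x ∷ xs) f g = trans (cong (f x + g x +_) (∑-+ xs f g)) (interchange (f x) (g x) _ _)
    where interchange : ∀ a b c d → a + b + (c + d) ≡ a + c + (b + d)
          interchange = solve-∀ ℚ-ring

  ∑-*ˡ : ∀ xs k (f : A → ℚ) → ∑[ a ∈ xs ] (k * f a) ≡ k * ∑ xs f
  ∑-*ˡ []       k f = sym (*-zeroʳ k)
  ∑-*ˡ (x ∷ xs) k f = trans (cong (k * f x +_) (∑-*ˡ xs k f)) (sym (*-distribˡ-+ k (f x) _))

  ∑-*ʳ : ∀ xs k (f : A → ℚ) → ∑[ a ∈ xs ] (f a * k) ≡ ∑ xs f * k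
  ∑-*ʳ xs k f = trans (∑-cong xs (λ a → *-comm (f a) k)) (trans (∑-*ˡ xs k f) (*-comm k _))

  ∑-neg : ∀ xs (f : A → ℚ) → ∑[ a ∈ xs ] (- f a) ≡ - ∑ xs f
  ∑-neg []       f = refl
  ∑-neg (x ∷ xs) f = trans (cong (- f x +_) (∑-neg xs f)) (sym (neg-distrib-+ (f x) _))

  ∑-- : ∀ xs (f g : A → ℚ) → ∑[ a ∈ xs ] (f a - g a) ≡ ∑ xs f - ∑ xs g
  ∑-- xs f g = trans (∑-+ xs f (-_ ∘ g)) (cong (∑ xs f +_) (∑-neg xs g))

  ∑-++ : ∀ xs ys (f : A → ℚ) → ∑ (xs ++ ys) f ≡ ∑ xs f + ∑ ys f
  ∑-++ []       ys f = sym (+-identityˡ _)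
  ∑-++ (x ∷ xs) ys f = trans (cong (f x +_) (∑-++ xs ys f)) (sym (+-assoc (f x) _ _))

  ∑-const : ∀ (xs : List A) k → ∑ xs (λ _ → k) ≡ ℕtoℚ (length xs) * k
  ∑-const []       k = sym (*-zeroˡ k)
  ∑-const (x ∷ xs) k = begin
    k + ∑ xs (λ _ → k)              ≡⟨ cong (k +_) (∑-const xs k) ⟩
    k + ℕtoℚ (length xs) * k       ≡⟨ factor k (ℕtoℚ (length xs)) ⟩
    (1ℚ + ℕtoℚ (length xs)) * k    ≡⟨ cong (_* k) (sym (ℕtoℚ-suc (length xs))) ⟩
    ℕtoℚ (suc (length xs)) * k     ∎
    where
    open ≡-Reasoning
    factor : ∀ k l → k + l * k ≡ (1ℚ + l) * k
    factor = solve-∀ ℚ-ring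

  ∑-nonNeg : ∀ xs (f : A → ℚ) → (∀ a → 0ℚ ≤ f a) → 0ℚ ≤ ∑ xs f
  ∑-nonNeg []       f f≥0 = ≤-refl
  ∑-nonNeg (x ∷ xs) f f≥0 = +-mono-≤ (f≥0 x) (∑-nonNeg xs f f≥0)

  ∑-pos⇒∃ : ∀ xs (f : A → ℚ) → 0ℚ < ∑ xs f → ∃ λ a → 0ℚ < f a
  ∑-pos⇒∃ []       f 0<0 = ⊥-elim (<-irrefl refl 0<0)
  ∑-pos⇒∃ (x ∷ xs) f ∑>0 with 0ℚ <? f x
  ... | yes fx>0 = x , fx>0
  ... | no  fx≯0 = ∑-pos⇒∃ xs f (≰⇒> λ ∑≤0 → <-irrefl refl (<-≤-trans ∑>0 (+-mono-≤ (≮⇒≥ fx≯0) ∑≤0)))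

module _ {A B : Set} where

  ∑-swap : ∀ (xs : List A) (ys : List B) (f : A → B → ℚ) →
           ∑[ a ∈ xs ] ∑[ b ∈ ys ] f a b ≡ ∑[ b ∈ ys ] ∑[ a ∈ xs ] f a b
  ∑-swap []       ys f = sym (∑-zero ys _ (λ _ → refl))
  ∑-swap (x ∷ xs) ys f = trans (cong (∑ ys (f x) +_) (∑-swap xs ys f)) (sym (∑-+ ys (f x) _))

  ∑-map : ∀ (g : A → B) xs (f : B → ℚ) → ∑ (map g xs) f ≡ ∑[ a ∈ xs ] f (g a)
  ∑-map g []       f = refl
  ∑-map g (x ∷ xs) f = cong (f (g x) +_) (∑-map g xs f)

  ∑-concatMap : ∀ (g : A → List B) xs (f : B → ℚ) → ∑ (concatMap g xs) f ≡ ∑[ a ∈ xs ] ∑ (g a) f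
  ∑-concatMap g []       f = refl
  ∑-concatMap g (x ∷ xs) f = trans (∑-++ (g x) (concatMap g xs) f) (cong (∑ (g x) f +_) (∑-concatMap g xs f))

∑-foldr : ∀ {A : Set} xs (f : A → ℚ) → foldr (λ x s → f x + s) 0ℚ xs ≡ ∑ xs f
∑-foldr []       f = refl
∑-foldr (x ∷ xs) f = cong (f x +_) (∑-foldr xs f)

∑-cong-All : ∀ {A : Set} {P : A → Set} {xs} {f g : A → ℚ} → All P xs → (∀ {a} → P a → f a ≡ g a) → ∑ xs f ≡ ∑ xs g
∑-cong-All []         f≗g = refl
∑-cong-All (pa ∷ pas) f≗g = cong₂ _+_ (f≗g pa) (∑-cong-All pas f≗g)

∑-01⇒ℕ : ∀ {A : Set} xs (f : A → ℚ) → (∀ a → f a ≡ 0ℚ ⊎ f a ≡ 1ℚ) → ∃ λ k → ∑ xs f ≡ ℕtoℚ k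
∑-01⇒ℕ []       f f01 = 0 , refl
∑-01⇒ℕ (x ∷ xs) f f01 with ∑-01⇒ℕ xs f f01 | f01 x
... | k , ∑≡k | inj₁ fx≡0 = k     , trans (cong₂ _+_ fx≡0 ∑≡k) (+-identityˡ _)
... | k , ∑≡k | inj₂ fx≡1 = suc k , trans (cong₂ _+_ fx≡1 ∑≡k) (sym (ℕtoℚ-suc k))

-- Only `does` is inspected, so 𝟙 of a decision built with map′ (Fin._≟_, Vec.≡-dec, …) reduces.
𝟙[_] : {P : Set} → Dec P → ℚ
𝟙[ P? ] = if does P? then 1ℚ else 0ℚ

module _ {P : Set} where

  𝟙-yes : (P? : Dec P) → P → 𝟙[ P? ] ≡ 1ℚ
  𝟙-yes (yes _) _ = refl
  𝟙-yes (no ¬p) p = ⊥-elim (¬p p)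

  𝟙-no : (P? : Dec P) → ¬ P → 𝟙[ P? ] ≡ 0ℚ
  𝟙-no (yes p) ¬p = ⊥-elim (¬p p)
  𝟙-no (no _)  _  = refl

  𝟙-¬ : (P? : Dec P) → 𝟙[ ¬? P? ] ≡ 1ℚ - 𝟙[ P? ]
  𝟙-¬ (yes _) = sym (+-inverseʳ 1ℚ)
  𝟙-¬ (no _)  = sym (+-identityʳ 1ℚ)

  𝟙-01 : (P? : Dec P) → 𝟙[ P? ] ≡ 0ℚ ⊎ 𝟙[ P? ] ≡ 1ℚ
  𝟙-01 (yes _) = inj₂ refl
  𝟙-01 (no _)  = inj₁ refl

  𝟙-yes-* : (P? : Dec P) → P → ∀ x → 𝟙[ P? ] * x ≡ x
  𝟙-yes-* P? p x = trans (cong (_* x) (𝟙-yes P? p)) (*-identityˡ x)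

  𝟙-no-* : (P? : Dec P) → ¬ P → ∀ x → 𝟙[ P? ] * x ≡ 0ℚ
  𝟙-no-* P? ¬p x = trans (cong (_* x) (𝟙-no P? ¬p)) (*-zeroˡ x)

  𝟙-¬-*-cong : (P? : Dec P) {x y : ℚ} → (¬ P → x ≡ y) → 𝟙[ ¬? P? ] * x ≡ 𝟙[ ¬? P? ] * y
  𝟙-¬-*-cong (yes _) {x} {y} _ = trans (*-zeroˡ x) (sym (*-zeroˡ y))
  𝟙-¬-*-cong (no ¬p)         f = cong (1ℚ *_) (f ¬p)

𝟙-×-dec : ∀ {P Q : Set} (P? : Dec P) (Q? : Dec Q) → 𝟙[ P? ×-dec Q? ] ≡ 𝟙[ P? ] * 𝟙[ Q? ]
𝟙-×-dec (yes _) (yes _) = sym (*-identityˡ 1ℚ)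
𝟙-×-dec (yes _) (no _)  = sym (*-zeroʳ 1ℚ)
𝟙-×-dec (no _)  Q?      = sym (*-zeroˡ 𝟙[ Q? ])

does≡true⇒ : ∀ {P : Set} (P? : Dec P) → does P? ≡ true → P
does≡true⇒ (yes p) _ = p

module Enumeration {A : Set} (_≟_ : DecidableEquality A) where

  δ : A → A → ℚ
  δ a b = 𝟙[ a ≟ b ]

  δ-sym : ∀ a b → δ a b ≡ δ b a
  δ-sym a b with a ≟ b | b ≟ a
  ... | yes _   | yes _   = refl
  ... | no  _   | no  _   = refl
  ... | yes a≡b | no  b≢a = ⊥-elim (b≢a (sym a≡b))
  ... | no  a≢b | yes b≡a = ⊥-elim (a≢b (sym b≡a))

  record IsEnumeration (xs : List A) : Set where
    field
      occurs-once : ∀ z → ∑[ a ∈ xs ] δ a z ≡ 1ℚ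

  ∑δ>0⇒∈ : ∀ xs z → 0ℚ < ∑[ a ∈ xs ] δ a z → z ∈ xs
  ∑δ>0⇒∈ []       z 0<0 = ⊥-elim (<-irrefl refl 0<0)
  ∑δ>0⇒∈ (x ∷ xs) z ∑>0 with x ≟ z
  ... | yes x≡z = here (sym x≡z)
  ... | no  _   = there (∑δ>0⇒∈ xs z (subst (0ℚ <_) (+-identityˡ _) ∑>0))

  module _ {xs : List A} (xs-enumeration : IsEnumeration xs) where

    open IsEnumeration xs-enumeration

    enumeration⇒∈ : ∀ z → z ∈ xs
    enumeration⇒∈ z = ∑δ>0⇒∈ xs z (subst (0ℚ <_) (sym (occurs-once z)) (positive⁻¹ 1ℚ))

    ∑-supported : ∀ z (f : A → ℚ) → (∀ a → a ≢ z → f a ≡ 0ℚ) → ∑ xs f ≡ f z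
    ∑-supported z f f≡0 = begin
      ∑ xs f                        ≡⟨ ∑-cong xs f≡δ*fz ⟩
      ∑[ a ∈ xs ] (δ a z * f z)     ≡⟨ ∑-*ʳ xs (f z) (λ a → δ a z) ⟩
      (∑[ a ∈ xs ] δ a z) * f z     ≡⟨ cong (_* f z) (occurs-once z) ⟩
      1ℚ * f z                      ≡⟨ *-identityˡ (f z) ⟩
      f z                           ∎
      where
      open ≡-Reasoning
      f≡δ*fz : ∀ a → f a ≡ δ a z * f z
      f≡δ*fz a with a ≟ z
      ... | yes refl = sym (*-identityˡ (f a))
      ... | no  a≢z  = trans (f≡0 a a≢z) (sym (*-zeroˡ (f z)))

    ∑-δ : ∀ w (f : A → ℚ) → ∑[ z ∈ xs ] (δ w z * f z) ≡ f w
    ∑-δ w f = trans (∑-supported w (λ z → δ w z * f z) (λ z z≢w → 𝟙-no-* (w ≟ z) (z≢w ∘ sym) (f z)))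
                    (𝟙-yes-* (w ≟ w) refl (f w))

    ∑-δ-1 : ∀ w → ∑[ z ∈ xs ] δ w z ≡ 1ℚ
    ∑-δ-1 w = trans (∑-cong xs (λ z → sym (*-identityʳ (δ w z)))) (∑-δ w (λ _ → 1ℚ))

    ∑-reindex : ∀ (h h⁻¹ : A → A) → (∀ a → h⁻¹ (h a) ≡ a) → (∀ b → h (h⁻¹ b) ≡ b) →
                ∀ (f : A → ℚ) → ∑[ a ∈ xs ] f (h a) ≡ ∑ xs f
    ∑-reindex h h⁻¹ h⁻¹∘h h∘h⁻¹ f = begin
      ∑[ a ∈ xs ] f (h a)                          ≡⟨ ∑-cong xs (λ a → sym (∑-δ (h a) f)) ⟩
      ∑[ a ∈ xs ] ∑[ b ∈ xs ] (δ (h a) b * f b)    ≡⟨ ∑-swap xs xs _ ⟩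
      ∑[ b ∈ xs ] ∑[ a ∈ xs ] (δ (h a) b * f b)    ≡⟨ ∑-cong xs (λ b → ∑-*ʳ xs (f b) (λ a → δ (h a) b)) ⟩
      ∑[ b ∈ xs ] ((∑[ a ∈ xs ] δ (h a) b) * f b)  ≡⟨ ∑-cong xs (λ b → cong (_* f b) (trans (∑-cong xs (δ-h b)) (occurs-once (h⁻¹ b)))) ⟩
      ∑[ b ∈ xs ] (1ℚ * f b)                       ≡⟨ ∑-cong xs (λ b → *-identityˡ (f b)) ⟩
      ∑ xs f                                       ∎
      where
      open ≡-Reasoning
      δ-h : ∀ b a → δ (h a) b ≡ δ a (h⁻¹ b)
      δ-h b a with h a ≟ b | a ≟ h⁻¹ b
      ... | yes _   | yes _   = refl
      ... | no  _   | no  _   = refl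
      ... | yes ha≡b | no  a≢  = ⊥-elim (a≢ (trans (sym (h⁻¹∘h a)) (cong h⁻¹ ha≡b)))
      ... | no  ha≢ | yes a≡ = ⊥-elim (ha≢ (trans (cong h a≡) (h∘h⁻¹ b)))

    ∑-split : ∀ z (f : A → ℚ) → ∑ xs f ≡ f z + ∑[ a ∈ xs ] (𝟙[ ¬? (a ≟ z) ] * f a)
    ∑-split z f = begin
      ∑ xs f                                                   ≡⟨ ∑-cong xs split ⟩
      ∑[ a ∈ xs ] (δ a z * f a + 𝟙[ ¬? (a ≟ z) ] * f a)        ≡⟨ ∑-+ xs _ _ ⟩
      ∑[ a ∈ xs ] (δ a z * f a) + ∑[ a ∈ xs ] (𝟙[ ¬? (a ≟ z) ] * f a)
                        ≡⟨ cong (_+ ∑[ a ∈ xs ] (𝟙[ ¬? (a ≟ z) ] * f a)) (trans (∑-cong xs (λ a → cong (_* f a) (δ-sym a z))) (∑-δ z f)) ⟩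
      f z + ∑[ a ∈ xs ] (𝟙[ ¬? (a ≟ z) ] * f a)                ∎
      where
      open ≡-Reasoning
      split : ∀ a → f a ≡ δ a z * f a + 𝟙[ ¬? (a ≟ z) ] * f a
      split a with a ≟ z
      ... | yes _ = sym (trans (cong₂ _+_ (*-identityˡ (f a)) (*-zeroˡ (f a))) (+-identityʳ (f a)))
      ... | no  _ = sym (trans (cong₂ _+_ (*-zeroˡ (f a)) (*-identityˡ (f a))) (+-identityˡ (f a)))

    ∑≢-const : ∀ z k → ∑[ a ∈ xs ] (𝟙[ ¬? (a ≟ z) ] * k) ≡ (ℕtoℚ (length xs) - 1ℚ) * k
    ∑≢-const z k = begin
      ∑[ a ∈ xs ] (𝟙[ ¬? (a ≟ z) ] * k)          ≡⟨ ∑-*ʳ xs k _ ⟩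
      (∑[ a ∈ xs ] 𝟙[ ¬? (a ≟ z) ]) * k          ≡⟨ cong (_* k) (∑-cong xs (λ a → 𝟙-¬ (a ≟ z))) ⟩
      (∑[ a ∈ xs ] (1ℚ - δ a z)) * k             ≡⟨ cong (_* k) (∑-- xs _ _) ⟩
      (∑ xs (λ _ → 1ℚ) - ∑[ a ∈ xs ] δ a z) * k  ≡⟨ cong (λ m → (m - ∑[ a ∈ xs ] δ a z) * k) (trans (∑-const xs 1ℚ) (*-identityʳ (ℕtoℚ (length xs)))) ⟩
      (ℕtoℚ (length xs) - ∑[ a ∈ xs ] δ a z) * k ≡⟨ cong (λ m → (ℕtoℚ (length xs) - m) * k) (occurs-once z) ⟩
      (ℕtoℚ (length xs) - 1ℚ) * k                ∎
      where open ≡-Reasoning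

    ≤-∑ : ∀ (f : A → ℚ) z → (∀ a → 0ℚ ≤ f a) → f z ≤ ∑ xs f
    ≤-∑ f z f≥0 = begin
      f z                                        ≡⟨ sym (+-identityʳ (f z)) ⟩
      f z + 0ℚ                                   ≤⟨ +-monoʳ-≤ (f z) (∑-nonNeg xs _ rest≥0) ⟩
      f z + ∑[ a ∈ xs ] (𝟙[ ¬? (a ≟ z) ] * f a)  ≡⟨ sym (∑-split z f) ⟩
      ∑ xs f                                     ∎
      where
      open ≤-Reasoning
      rest≥0 : ∀ a → 0ℚ ≤ 𝟙[ ¬? (a ≟ z) ] * f a
      rest≥0 a with a ≟ z
      ... | yes _ = ≤-reflexive (sym (*-zeroˡ (f a)))
      ... | no  _ = subst (0ℚ ≤_) (sym (*-identityˡ (f a))) (f≥0 a)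

length-concatMap-const : ∀ {A B : Set} (f : A → List B) k → (∀ a → length (f a) ≡ k) →
                         ∀ xs → length (concatMap f xs) ≡ length xs ℕ.* k
length-concatMap-const f k |f|≡k []       = refl
length-concatMap-const f k |f|≡k (x ∷ xs) =
  trans (List.length-++ (f x)) (cong₂ ℕ._+_ (|f|≡k x) (length-concatMap-const f k |f|≡k xs))

allFin-enumeration : ∀ k → Enumeration.IsEnumeration (Fin._≟_ {k}) (allFin k)
allFin-enumeration k = record { occurs-once = occurs-once k }
  where
  δ : ∀ {k} → Fin k → Fin k → ℚ
  δ {k} = Enumeration.δ (Fin._≟_ {k})
  occurs-once : ∀ k (z : Fin k) → ∑[ i ∈ allFin k ] δ i z ≡ 1ℚ
  occurs-once (suc k) z = begin
    δ Fin.zero z + ∑ (tabulate Fin.suc) (λ i → δ i z)          ≡⟨ cong (λ is → δ Fin.zero z + ∑ is (λ i → δ i z)) (sym (List.map-tabulate id Fin.suc)) ⟩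
    δ Fin.zero z + ∑ (map Fin.suc (allFin k)) (λ i → δ i z)    ≡⟨ cong (δ Fin.zero z +_) (∑-map Fin.suc (allFin k) _) ⟩
    δ Fin.zero z + ∑[ i ∈ allFin k ] δ (Fin.suc i) z           ≡⟨ split z ⟩
    1ℚ                                                         ∎
    where
    open ≡-Reasoning
    split : ∀ z → δ Fin.zero z + ∑[ i ∈ allFin k ] δ (Fin.suc i) z ≡ 1ℚ
    split Fin.zero    = trans (cong (1ℚ +_) (∑-zero (allFin k) _ (λ _ → refl))) (+-identityʳ 1ℚ)
    split (Fin.suc j) = trans (+-identityˡ _) (occurs-once k j)

Fin-distinct⇒2≤ : ∀ {k} (i j : Fin k) → i ≢ j → 2 ℕ.≤ k
Fin-distinct⇒2≤ Fin.zero Fin.zero i≢j = ⊥-elim (i≢j refl)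
Fin-distinct⇒2≤ {suc (suc _)} _ _ _ = ℕ.s≤s (ℕ.s≤s ℕ.z≤n)

module FiniteFieldProperties {q : ℕ} (𝔽 : FiniteField q) where

  open FiniteField 𝔽 renaming (_+_ to infixl 6 _+ᶠ_; _*_ to infixl 7 _*ᶠ_; -_ to infix 8 -ᶠ_)
  module F = IsCommutativeRing isCommutativeRing

  _≟ᶠ_ : DecidableEquality Carrier
  _≟ᶠ_ = Fin.inj⇒≟ (↔⇒↣ (↔-sym enum))

  open Enumeration _≟ᶠ_
  open Enumeration (Fin._≟_ {q}) using () renaming (δ to δᶠⁱⁿ)

  -- The same list as AG.elements 𝔽 n, from which AG.allVecs is built.
  elements : List Carrier
  elements = map (Inverse.to enum) (allFin q)

  elements-enumeration : IsEnumeration elements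
  elements-enumeration = record { occurs-once = occurs-once }
    where
    occurs-once : ∀ z → ∑[ a ∈ elements ] δ a z ≡ 1ℚ
    occurs-once z = begin
      ∑[ a ∈ elements ] δ a z                      ≡⟨ ∑-map (Inverse.to enum) (allFin q) _ ⟩
      ∑[ i ∈ allFin q ] δ (Inverse.to enum i) z    ≡⟨ ∑-cong (allFin q) δ-to ⟩
      ∑[ i ∈ allFin q ] δᶠⁱⁿ i (Inverse.from enum z) ≡⟨ Enumeration.IsEnumeration.occurs-once (allFin-enumeration q) _ ⟩
      1ℚ                                           ∎
      where
      open ≡-Reasoning
      δ-to : ∀ i → δ (Inverse.to enum i) z ≡ δᶠⁱⁿ i (Inverse.from enum z)
      δ-to i = cong (λ j → δᶠⁱⁿ j (Inverse.from enum z)) (Inverse.strictlyInverseʳ enum i)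

  length-elements : length elements ≡ q
  length-elements = trans (List.length-map (Inverse.to enum) (allFin q)) (List.length-tabulate id)

  2≤q : 2 ℕ.≤ q
  2≤q = Fin-distinct⇒2≤ (Inverse.from enum 0#) (Inverse.from enum 1#)
          (0≢1 ∘ Injection.injective (↔⇒↣ (↔-sym enum)))

  -1# : Carrier
  -1# = -ᶠ 1#

  x+-1*x≡0 : ∀ x → x +ᶠ -1# *ᶠ x ≡ 0#
  x+-1*x≡0 x = begin
    x +ᶠ -1# *ᶠ x           ≡⟨ cong (_+ᶠ -1# *ᶠ x) (sym (F.*-identityˡ x)) ⟩
    1# *ᶠ x +ᶠ -1# *ᶠ x     ≡⟨ sym (F.distribʳ x 1# -1#) ⟩
    (1# +ᶠ -1#) *ᶠ x        ≡⟨ cong (_*ᶠ x) (F.-‿inverseʳ 1#) ⟩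
    0# *ᶠ x                 ≡⟨ F.zeroˡ x ⟩
    0#                      ∎
    where open ≡-Reasoning

  x+[y+-1*x]≡y : ∀ x y → x +ᶠ (y +ᶠ -1# *ᶠ x) ≡ y
  x+[y+-1*x]≡y x y = begin
    x +ᶠ (y +ᶠ -1# *ᶠ x)    ≡⟨ cong (x +ᶠ_) (F.+-comm y _) ⟩
    x +ᶠ (-1# *ᶠ x +ᶠ y)    ≡⟨ sym (F.+-assoc x _ y) ⟩
    (x +ᶠ -1# *ᶠ x) +ᶠ y    ≡⟨ cong (_+ᶠ y) (x+-1*x≡0 x) ⟩
    0# +ᶠ y                 ≡⟨ F.+-identityˡ y ⟩
    y                       ∎
    where open ≡-Reasoning

  [x*y]*z≡x : ∀ x {y z} → z *ᶠ y ≡ 1# → (x *ᶠ y) *ᶠ z ≡ x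
  [x*y]*z≡x x {y} {z} zy≡1 =
    trans (F.*-assoc x y z) (trans (cong (x *ᶠ_) (trans (F.*-comm y z) zy≡1)) (F.*-identityʳ x))

  x*[y*z]≡z : ∀ {x y} → x *ᶠ y ≡ 1# → ∀ z → x *ᶠ (y *ᶠ z) ≡ z
  x*[y*z]≡z {x} {y} xy≡1 z = trans (sym (F.*-assoc x y z)) (trans (cong (_*ᶠ z) xy≡1) (F.*-identityˡ z))

  *-cancelʳ-≢0 : ∀ {s t} x → x ≢ 0# → s *ᶠ x ≡ t *ᶠ x → s ≡ t
  *-cancelʳ-≢0 {s} {t} x x≢0 sx≡tx =
    trans (sym ([x*y]*z≡x s yx≡1)) (trans (cong (_*ᶠ y) sx≡tx) ([x*y]*z≡x t yx≡1))
    where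
    y : Carrier
    y = proj₁ (inverse x x≢0)
    yx≡1 : y *ᶠ x ≡ 1#
    yx≡1 = trans (F.*-comm y x) (proj₂ (inverse x x≢0))

  1≤q : 1 ℕ.≤ q
  1≤q = ℕ.≤-trans (ℕ.s≤s ℕ.z≤n) 2≤q

  q≤q^ : ∀ {k} → 1 ℕ.≤ k → q ℕ.≤ q ℕ.^ k
  q≤q^ {k} 1≤k = ℕ.≤-trans (ℕ.≤-reflexive (sym (ℕ.*-identityʳ q))) (ℕ.^-monoʳ-≤ q {{ℕ.>-nonZero 1≤q}} 1≤k)

  2+q≤q^ : ∀ {k} → 2 ℕ.≤ k → 2 ℕ.+ q ℕ.≤ q ℕ.^ k
  2+q≤q^ {k} 2≤k = begin
    2 ℕ.+ q      ≤⟨ ℕ.+-monoˡ-≤ q 2≤q ⟩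
    q ℕ.+ q      ≡⟨ cong (q ℕ.+_) (sym (ℕ.+-identityʳ q)) ⟩
    2 ℕ.* q      ≤⟨ ℕ.*-monoˡ-≤ q 2≤q ⟩
    q ℕ.* q      ≡⟨ cong (q ℕ.*_) (sym (ℕ.*-identityʳ q)) ⟩
    q ℕ.^ 2      ≤⟨ ℕ.^-monoʳ-≤ q {{ℕ.>-nonZero 1≤q}} 2≤k ⟩
    q ℕ.^ k      ∎
    where open ℕ.≤-Reasoning

module VectorSpace {q : ℕ} (𝔽 : FiniteField q) where

  open FiniteField 𝔽 renaming (_+_ to infixl 6 _+ᶠ_; _*_ to infixl 7 _*ᶠ_; -_ to infix 8 -ᶠ_)
  open FiniteFieldProperties 𝔽

  -- Length-polymorphic versions of AG._⊕_, AG._·_ and AG.zeroV, with which they agree definitionally.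
  infixl 6 _⊕_ _⊖_
  infixr 7 _·_

  _⊕_ : ∀ {m} → Vec Carrier m → Vec Carrier m → Vec Carrier m
  _⊕_ = zipWith _+ᶠ_

  _·_ : ∀ {m} → Carrier → Vec Carrier m → Vec Carrier m
  t · v = Vec.map (t *ᶠ_) v

  _⊖_ : ∀ {m} → Vec Carrier m → Vec Carrier m → Vec Carrier m
  u ⊖ v = u ⊕ -1# · v

  𝟎 : ∀ {m} → Vec Carrier m
  𝟎 = replicate _ 0#

  ·-zeroˡ : ∀ {m} (v : Vec Carrier m) → 0# · v ≡ 𝟎
  ·-zeroˡ []      = refl
  ·-zeroˡ (x ∷ v) = cong₂ _∷_ (F.zeroˡ x) (·-zeroˡ v)

  ·-distribˡ : ∀ {m} t (u v : Vec Carrier m) → t · (u ⊕ v) ≡ t · u ⊕ t · v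
  ·-distribˡ t []      []      = refl
  ·-distribˡ t (x ∷ u) (y ∷ v) = cong₂ _∷_ (F.distribˡ t x y) (·-distribˡ t u v)

  ·-distribʳ : ∀ {m} s t (v : Vec Carrier m) → (s +ᶠ t) · v ≡ s · v ⊕ t · v
  ·-distribʳ s t []      = refl
  ·-distribʳ s t (x ∷ v) = cong₂ _∷_ (F.distribʳ x s t) (·-distribʳ s t v)

  ·-cancelʳ-≢𝟎 : ∀ {m s t} (d : Vec Carrier m) → d ≢ 𝟎 → s · d ≡ t · d → s ≡ t
  ·-cancelʳ-≢𝟎 []      d≢𝟎 _ = ⊥-elim (d≢𝟎 refl)
  ·-cancelʳ-≢𝟎 (x ∷ d) d≢𝟎 sd≡td with x ≟ᶠ 0#
  ... | yes refl = ·-cancelʳ-≢𝟎 d (d≢𝟎 ∘ cong (0# ∷_)) (Vec.∷-injectiveʳ sd≡td)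
  ... | no  x≢0  = *-cancelʳ-≢0 x x≢0 (Vec.∷-injectiveˡ sd≡td)

  module _ {m : ℕ} where

    ⊕-assoc : ∀ (u v w : Vec Carrier m) → (u ⊕ v) ⊕ w ≡ u ⊕ (v ⊕ w)
    ⊕-assoc = Vec.zipWith-assoc F.+-assoc

    ⊕-comm : ∀ (u v : Vec Carrier m) → u ⊕ v ≡ v ⊕ u
    ⊕-comm = Vec.zipWith-comm F.+-comm

    ⊕-identityˡ : ∀ (v : Vec Carrier m) → 𝟎 ⊕ v ≡ v
    ⊕-identityˡ = Vec.zipWith-identityˡ F.+-identityˡ

    ⊕-identityʳ : ∀ (v : Vec Carrier m) → v ⊕ 𝟎 ≡ v
    ⊕-identityʳ = Vec.zipWith-identityʳ F.+-identityʳ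

    ·-assoc : ∀ s t (v : Vec Carrier m) → (s *ᶠ t) · v ≡ s · t · v
    ·-assoc s t v = trans (Vec.map-cong (F.*-assoc s t) v) (Vec.map-∘ (s *ᶠ_) (t *ᶠ_) v)

    ·-identityˡ : ∀ (v : Vec Carrier m) → 1# · v ≡ v
    ·-identityˡ v = trans (Vec.map-cong F.*-identityˡ v) (Vec.map-id v)

    ·-zeroʳ : ∀ t → t · 𝟎 ≡ 𝟎 {m}
    ·-zeroʳ t = trans (Vec.map-replicate (t *ᶠ_) 0# m) (cong (replicate m) (F.zeroʳ t))

    v⊖v≡𝟎 : ∀ (v : Vec Carrier m) → v ⊖ v ≡ 𝟎
    v⊖v≡𝟎 v = begin
      v ⊕ -1# · v             ≡⟨ cong (_⊕ -1# · v) (sym (·-identityˡ v)) ⟩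
      1# · v ⊕ -1# · v        ≡⟨ sym (·-distribʳ 1# -1# v) ⟩
      (1# +ᶠ -1#) · v         ≡⟨ cong (_· v) (F.-‿inverseʳ 1#) ⟩
      0# · v                  ≡⟨ ·-zeroˡ v ⟩
      𝟎                       ∎
      where open ≡-Reasoning

    p⊕x⊖p≡x : ∀ (p x : Vec Carrier m) → p ⊕ x ⊖ p ≡ x
    p⊕x⊖p≡x p x = begin
      (p ⊕ x) ⊕ -1# · p       ≡⟨ cong (_⊕ -1# · p) (⊕-comm p x) ⟩
      (x ⊕ p) ⊕ -1# · p       ≡⟨ ⊕-assoc x p _ ⟩
      x ⊕ (p ⊖ p)             ≡⟨ cong (x ⊕_) (v⊖v≡𝟎 p) ⟩
      x ⊕ 𝟎                   ≡⟨ ⊕-identityʳ x ⟩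
      x                       ∎
      where open ≡-Reasoning

    p⊕[z⊖p]≡z : ∀ (p z : Vec Carrier m) → p ⊕ (z ⊖ p) ≡ z
    p⊕[z⊖p]≡z p z = begin
      p ⊕ (z ⊕ -1# · p)       ≡⟨ cong (p ⊕_) (⊕-comm z _) ⟩
      p ⊕ (-1# · p ⊕ z)       ≡⟨ sym (⊕-assoc p _ z) ⟩
      (p ⊖ p) ⊕ z             ≡⟨ cong (_⊕ z) (v⊖v≡𝟎 p) ⟩
      𝟎 ⊕ z                   ≡⟨ ⊕-identityˡ z ⟩
      z                       ∎
      where open ≡-Reasoning

    ⊕-cancelˡ : ∀ (a : Vec Carrier m) {x y} → a ⊕ x ≡ a ⊕ y → x ≡ y
    ⊕-cancelˡ a {x} {y} ax≡ay = trans (sym (p⊕x⊖p≡x a x)) (trans (cong (_⊖ a) ax≡ay) (p⊕x⊖p≡x a y))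

    p⊕0·d≡p : ∀ (p d : Vec Carrier m) → p ⊕ 0# · d ≡ p
    p⊕0·d≡p p d = trans (cong (p ⊕_) (·-zeroˡ d)) (⊕-identityʳ p)

    [a⊕s·d]⊕u·[t·d] : ∀ (a d : Vec Carrier m) s u t → (a ⊕ s · d) ⊕ u · t · d ≡ a ⊕ (s +ᶠ u *ᶠ t) · d
    [a⊕s·d]⊕u·[t·d] a d s u t = begin
      (a ⊕ s · d) ⊕ u · t · d     ≡⟨ ⊕-assoc a _ _ ⟩
      a ⊕ (s · d ⊕ u · t · d)     ≡⟨ cong (λ w → a ⊕ (s · d ⊕ w)) (sym (·-assoc u t d)) ⟩
      a ⊕ (s · d ⊕ (u *ᶠ t) · d)  ≡⟨ cong (a ⊕_) (sym (·-distribʳ s (u *ᶠ t) d)) ⟩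
      a ⊕ (s +ᶠ u *ᶠ t) · d       ∎
      where open ≡-Reasoning

    p⊕t·[e⊕l·f] : ∀ (p e f : Vec Carrier m) t l → p ⊕ t · (e ⊕ l · f) ≡ (p ⊕ t · e) ⊕ (t *ᶠ l) · f
    p⊕t·[e⊕l·f] p e f t l = begin
      p ⊕ t · (e ⊕ l · f)         ≡⟨ cong (p ⊕_) (·-distribˡ t e _) ⟩
      p ⊕ (t · e ⊕ t · l · f)     ≡⟨ cong (λ w → p ⊕ (t · e ⊕ w)) (sym (·-assoc t l f)) ⟩
      p ⊕ (t · e ⊕ (t *ᶠ l) · f)  ≡⟨ sym (⊕-assoc p _ _) ⟩
      (p ⊕ t · e) ⊕ (t *ᶠ l) · f  ∎
      where open ≡-Reasoning

    x·y·v≡v : ∀ {x y} → x *ᶠ y ≡ 1# → ∀ (v : Vec Carrier m) → x · y · v ≡ v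
    x·y·v≡v {x} {y} xy≡1 v = trans (sym (·-assoc x y v)) (trans (cong (_· v) xy≡1) (·-identityˡ v))

  independent-pair : ∀ {m} → 2 ℕ.≤ m → ∃ λ (e₁ : Vec Carrier m) → ∃ λ e₂ → e₂ ≢ 𝟎 × (∀ l → e₁ ⊕ l · e₂ ≢ 𝟎)
  independent-pair (ℕ.s≤s (ℕ.s≤s _)) = 1# ∷ 0# ∷ 𝟎 , 0# ∷ 1# ∷ 𝟎 , e₂≢𝟎 , e₁⊕l·e₂≢𝟎
    where
    e₂≢𝟎 : 0# ∷ 1# ∷ 𝟎 ≢ 𝟎
    e₂≢𝟎 eq = 0≢1 (sym (Vec.∷-injectiveˡ (Vec.∷-injectiveʳ eq)))
    e₁⊕l·e₂≢𝟎 : ∀ l → (1# ∷ 0# ∷ 𝟎) ⊕ l · (0# ∷ 1# ∷ 𝟎) ≢ 𝟎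
    e₁⊕l·e₂≢𝟎 l eq = 0≢1 (sym (trans (sym (trans (cong (1# +ᶠ_) (F.zeroʳ l)) (F.+-identityʳ 1#))) (Vec.∷-injectiveˡ eq)))

module AffineGeometry {q : ℕ} (𝔽 : FiniteField q) (n : ℕ) where

  open FiniteField 𝔽 renaming (_+_ to infixl 6 _+ᶠ_; _*_ to infixl 7 _*ᶠ_; -_ to infix 8 -ᶠ_)
  open FiniteFieldProperties 𝔽
  open VectorSpace 𝔽
  open AG 𝔽 n using (Point; PointSet; points; allVecs; IsLine; sumOn; _≐_; LineSet; IsCameronLiebler; size)

  infix 4 _≟ᵛ_
  _≟ᵛ_ : ∀ {m} → DecidableEquality (Vec Carrier m)
  _≟ᵛ_ = Vec.≡-dec _≟ᶠ_

  module Eᶠ = Enumeration _≟ᶠ_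
  module Eᵛ {m : ℕ} = Enumeration (_≟ᵛ_ {m})

  allVecs-enumeration : ∀ m → Eᵛ.IsEnumeration (allVecs m)
  allVecs-enumeration m = record { occurs-once = occurs-once m }
    where
    occurs-once : ∀ m (v : Vec Carrier m) → ∑[ w ∈ allVecs m ] Eᵛ.δ w v ≡ 1ℚ
    occurs-once zero    []      = refl
    occurs-once (suc m) (b ∷ v) = begin
      ∑ (allVecs (suc m)) (λ w → Eᵛ.δ w (b ∷ v))
        ≡⟨ ∑-concatMap (λ a → map (a ∷_) (allVecs m)) elements _ ⟩
      ∑[ a ∈ elements ] ∑ (map (a ∷_) (allVecs m)) (λ w → Eᵛ.δ w (b ∷ v))
        ≡⟨ ∑-cong elements (λ a → ∑-map (a ∷_) (allVecs m) _) ⟩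
      ∑[ a ∈ elements ] ∑[ w ∈ allVecs m ] Eᵛ.δ (a ∷ w) (b ∷ v)
        ≡⟨ ∑-cong elements (λ a → ∑-cong (allVecs m) (λ w → 𝟙-×-dec (a ≟ᶠ b) (w ≟ᵛ v))) ⟩
      ∑[ a ∈ elements ] ∑[ w ∈ allVecs m ] (Eᶠ.δ a b * Eᵛ.δ w v)
        ≡⟨ ∑-cong elements (λ a → ∑-*ˡ (allVecs m) (Eᶠ.δ a b) _) ⟩
      ∑[ a ∈ elements ] (Eᶠ.δ a b * ∑[ w ∈ allVecs m ] Eᵛ.δ w v)
        ≡⟨ ∑-cong elements (λ a → trans (cong (Eᶠ.δ a b *_) (occurs-once m v)) (*-identityʳ _)) ⟩
      ∑[ a ∈ elements ] Eᶠ.δ a b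
        ≡⟨ Eᶠ.IsEnumeration.occurs-once elements-enumeration b ⟩
      1ℚ ∎
      where open ≡-Reasoning

  length-allVecs : ∀ m → length (allVecs m) ≡ q ℕ.^ m
  length-allVecs zero    = refl
  length-allVecs (suc m) = begin
    length (allVecs (suc m))             ≡⟨ length-concatMap-const _ (q ℕ.^ m) |a∷allVecs| elements ⟩
    length elements ℕ.* q ℕ.^ m          ≡⟨ cong (ℕ._* q ℕ.^ m) length-elements ⟩
    q ℕ.* q ℕ.^ m                        ∎
    where
    open ≡-Reasoning
    |a∷allVecs| : ∀ a → length (map (a ∷_) (allVecs m)) ≡ q ℕ.^ m
    |a∷allVecs| a = trans (List.length-map (a ∷_) (allVecs m)) (length-allVecs m)

  points-enumeration : Eᵛ.IsEnumeration points
  points-enumeration = allVecs-enumeration n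
  Q Qⁿ : ℚ
  Q  = ℕtoℚ q
  Qⁿ = ℕtoℚ (q ℕ.^ n)

  Q>1 : 1ℚ < Q
  Q>1 = ℕtoℚ-mono-< 2≤q

  Q>0 : 0ℚ < Q
  Q>0 = <-trans (positive⁻¹ 1ℚ) Q>1

  Qⁿ>1 : 1 ℕ.≤ n → 1ℚ < Qⁿ
  Qⁿ>1 1≤n = ℕtoℚ-mono-< (ℕ.≤-trans 2≤q (q≤q^ 1≤n))

  ∑-nonzero-points : ∀ k → ∑[ d ∈ points ] (𝟙[ ¬? (d ≟ᵛ 𝟎) ] * k) ≡ (Qⁿ - 1ℚ) * k
  ∑-nonzero-points k = trans (Eᵛ.∑≢-const points-enumeration 𝟎 k)
                             (cong (λ m → (ℕtoℚ m - 1ℚ) * k) (length-allVecs n))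

  ∑-nonzero-elements : ∀ k → ∑[ t ∈ elements ] (𝟙[ ¬? (t ≟ᶠ 0#) ] * k) ≡ (Q - 1ℚ) * k
  ∑-nonzero-elements k = trans (Eᶠ.∑≢-const elements-enumeration 0# k)
                               (cong (λ m → (ℕtoℚ m - 1ℚ) * k) length-elements)

  ∑-elements-const : ∀ k → ∑ elements (λ _ → k) ≡ Q * k
  ∑-elements-const k = trans (∑-const elements k) (cong (λ m → ℕtoℚ m * k) length-elements)

  ∑-points-const : ∀ k → ∑ points (λ _ → k) ≡ Qⁿ * k
  ∑-points-const k = trans (∑-const points k) (cong (λ m → ℕtoℚ m * k) (length-allVecs n))

  line : Point → Point → PointSet
  line a d z = does (any? (λ t → z ≟ᵛ a ⊕ t · d) elements)

  line⁺ : ∀ a d {z} t → z ≡ a ⊕ t · d → line a d z ≡ true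
  line⁺ a d t z≡ = dec-true (any? _ elements) (Any.map (λ { refl → z≡ }) (Eᶠ.enumeration⇒∈ elements-enumeration t))

  line⁻ : ∀ a d {z} → line a d z ≡ true → ∃ λ t → z ≡ a ⊕ t · d
  line⁻ a d {z} z∈ = Any.satisfied (does≡true⇒ (any? (λ t → z ≟ᵛ a ⊕ t · d) elements) z∈)

  line-injective : ∀ (a : Point) {d} → d ≢ 𝟎 → ∀ {s t} → a ⊕ s · d ≡ a ⊕ t · d → s ≡ t
  line-injective a {d} d≢𝟎 eq = ·-cancelʳ-≢𝟎 d d≢𝟎 (⊕-cancelˡ a eq)

  Parametrises : Point → Point → PointSet → Set
  Parametrises a d ℓ = ∀ z → (ℓ z ≡ true → ∃ λ t → z ≡ a ⊕ t · d) × ((∃ λ t → z ≡ a ⊕ t · d) → ℓ z ≡ true)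

  line-parametrises : ∀ a d → Parametrises a d (line a d)
  line-parametrises a d z = line⁻ a d , λ { (t , z≡) → line⁺ a d t z≡ }

  line-isLine : ∀ (a : Point) {d} → d ≢ 𝟎 → IsLine (line a d)
  line-isLine a {d} d≢𝟎 = a , d , d≢𝟎 , line-parametrises a d

  infix 4 _≐?_
  _≐?_ : (ℓ m : PointSet) → Dec (ℓ ≐ m)
  ℓ ≐? m = map′ (λ ℓ≗m z → All.lookup ℓ≗m (Eᵛ.enumeration⇒∈ points-enumeration z))
                (λ ℓ≐m → All.tabulate (λ {z} _ → ℓ≐m z))
                (All.all? (λ z → ℓ z Bool.≟ m z) points)

  s·d≢𝟎 : ∀ {s} {d : Point} → s ≢ 0# → d ≢ 𝟎 → s · d ≢ 𝟎
  s·d≢𝟎 {s} {d} s≢0 d≢𝟎 s·d≡𝟎 = s≢0 (·-cancelʳ-≢𝟎 d d≢𝟎 (trans s·d≡𝟎 (sym (·-zeroˡ d))))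

  module _ {ℓ a d₀} (d₀≢𝟎 : d₀ ≢ 𝟎) (par : Parametrises a d₀ ℓ) where

    ∑-δ-parametrised : ∀ z x → ∑[ t ∈ elements ] (Eᵛ.δ (a ⊕ t · d₀) z * x) ≡ (if ℓ z then x else 0ℚ)
    ∑-δ-parametrised z x with ℓ z in z∈ℓ
    ... | true with proj₁ (par z) z∈ℓ
    ...   | t₀ , z≡ = trans
              (Eᶠ.∑-supported elements-enumeration t₀ (λ t → Eᵛ.δ (a ⊕ t · d₀) z * x) λ t t≢t₀ →
                𝟙-no-* (a ⊕ t · d₀ ≟ᵛ z) (λ eq → t≢t₀ (line-injective a d₀≢𝟎 (trans eq z≡))) x)
              (𝟙-yes-* (a ⊕ t₀ · d₀ ≟ᵛ z) (sym z≡) x)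
    ∑-δ-parametrised z x | false = ∑-zero elements (λ t → Eᵛ.δ (a ⊕ t · d₀) z * x) λ t →
      𝟙-no-* (a ⊕ t · d₀ ≟ᵛ z) (λ eq → false≢true (trans (sym z∈ℓ) (proj₂ (par z) (t , sym eq)))) x
      where
      false≢true : false ≢ true
      false≢true ()

    sumOn-parametrised : ∀ (c : Point → ℚ) → sumOn c ℓ ≡ ∑[ t ∈ elements ] c (a ⊕ t · d₀)
    sumOn-parametrised c = begin
      sumOn c ℓ                                                    ≡⟨ ∑-foldr points _ ⟩
      ∑[ z ∈ points ] (if ℓ z then c z else 0ℚ)                    ≡⟨ ∑-cong points (λ z → sym (∑-δ-parametrised z (c z))) ⟩
      ∑[ z ∈ points ] ∑[ t ∈ elements ] (Eᵛ.δ (a ⊕ t · d₀) z * c z) ≡⟨ ∑-swap points elements _ ⟩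
      ∑[ t ∈ elements ] ∑[ z ∈ points ] (Eᵛ.δ (a ⊕ t · d₀) z * c z) ≡⟨ ∑-cong elements (λ t → Eᵛ.∑-δ points-enumeration (a ⊕ t · d₀) c) ⟩
      ∑[ t ∈ elements ] c (a ⊕ t · d₀)                              ∎
      where open ≡-Reasoning

    line≐⇒ : ∀ p {d} → d ≢ 𝟎 → line p d ≐ ℓ → ℓ p ≡ true × ∃ λ s → s ≢ 0# × s · d₀ ≡ d
    line≐⇒ p {d} d≢𝟎 line≐ℓ = p∈ℓ , s , s≢0 , s·d₀≡d
      where
      p∈ℓ : ℓ p ≡ true
      p∈ℓ = trans (sym (line≐ℓ p)) (line⁺ p d 0# (sym (p⊕0·d≡p p d)))
      p⊕d∈ℓ : ℓ (p ⊕ 1# · d) ≡ true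
      p⊕d∈ℓ = trans (sym (line≐ℓ _)) (line⁺ p d 1# refl)
      t₀ t₁ s : Carrier
      t₀ = proj₁ (proj₁ (par p) p∈ℓ)
      t₁ = proj₁ (proj₁ (par _) p⊕d∈ℓ)
      s = t₁ +ᶠ -1# *ᶠ t₀
      s·d₀≡d : s · d₀ ≡ d
      s·d₀≡d = ⊕-cancelˡ p (begin
        p ⊕ s · d₀                   ≡⟨ cong (λ w → w ⊕ s · d₀) (proj₂ (proj₁ (par p) p∈ℓ)) ⟩
        (a ⊕ t₀ · d₀) ⊕ s · d₀       ≡⟨ cong ((a ⊕ t₀ · d₀) ⊕_) (sym (·-identityˡ (s · d₀))) ⟩
        (a ⊕ t₀ · d₀) ⊕ 1# · s · d₀  ≡⟨ [a⊕s·d]⊕u·[t·d] a d₀ t₀ 1# s ⟩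
        a ⊕ (t₀ +ᶠ 1# *ᶠ s) · d₀     ≡⟨ cong (λ x → a ⊕ (t₀ +ᶠ x) · d₀) (F.*-identityˡ s) ⟩
        a ⊕ (t₀ +ᶠ s) · d₀           ≡⟨ cong (λ x → a ⊕ x · d₀) (x+[y+-1*x]≡y t₀ t₁) ⟩
        a ⊕ t₁ · d₀                  ≡⟨ sym (proj₂ (proj₁ (par _) p⊕d∈ℓ)) ⟩
        p ⊕ 1# · d                   ≡⟨ cong (p ⊕_) (·-identityˡ d) ⟩
        p ⊕ d                        ∎)
        where open ≡-Reasoning
      s≢0 : s ≢ 0#
      s≢0 s≡0 = d≢𝟎 (trans (sym s·d₀≡d) (trans (cong (_· d₀) s≡0) (·-zeroˡ d₀)))

    ⇒line≐ : ∀ p {d s} → ℓ p ≡ true → s ≢ 0# → s · d₀ ≡ d → line p d ≐ ℓ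
    ⇒line≐ p {d} {s} p∈ℓ s≢0 s·d₀≡d z = ⇔→≡ {z = true} (mk⇔ on-line⇒on-ℓ on-ℓ⇒on-line)
      where
      t₀ : Carrier
      t₀ = proj₁ (proj₁ (par p) p∈ℓ)
      p⊕u·d : ∀ u → p ⊕ u · d ≡ a ⊕ (t₀ +ᶠ u *ᶠ s) · d₀
      p⊕u·d u = begin
        p ⊕ u · d                   ≡⟨ cong₂ (λ x y → x ⊕ u · y) (proj₂ (proj₁ (par p) p∈ℓ)) (sym s·d₀≡d) ⟩
        (a ⊕ t₀ · d₀) ⊕ u · s · d₀  ≡⟨ [a⊕s·d]⊕u·[t·d] a d₀ t₀ u s ⟩
        a ⊕ (t₀ +ᶠ u *ᶠ s) · d₀     ∎
        where open ≡-Reasoning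
      on-line⇒on-ℓ : line p d z ≡ true → ℓ z ≡ true
      on-line⇒on-ℓ z∈ with line⁻ p d z∈
      ... | u , z≡ = proj₂ (par z) (_ , trans z≡ (p⊕u·d u))
      on-ℓ⇒on-line : ℓ z ≡ true → line p d z ≡ true
      on-ℓ⇒on-line z∈ with proj₁ (par z) z∈ | inverse s s≢0
      ... | t , z≡ | s⁻¹ , ss⁻¹≡1 = line⁺ p d u (begin
        z                            ≡⟨ z≡ ⟩
        a ⊕ t · d₀                   ≡⟨ cong (λ x → a ⊕ x · d₀) (sym (x+[y+-1*x]≡y t₀ t)) ⟩
        a ⊕ (t₀ +ᶠ (t +ᶠ -1# *ᶠ t₀)) · d₀ ≡⟨ cong (λ x → a ⊕ (t₀ +ᶠ x) · d₀) (sym ([x*y]*z≡x _ ss⁻¹≡1)) ⟩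
        a ⊕ (t₀ +ᶠ u *ᶠ s) · d₀      ≡⟨ sym (p⊕u·d u) ⟩
        p ⊕ u · d                    ∎)
        where
        open ≡-Reasoning
        u : Carrier
        u = (t +ᶠ -1# *ᶠ t₀) *ᶠ s⁻¹

    onℓ : Point → ℚ
    onℓ p = ∑[ t ∈ elements ] Eᵛ.δ (a ⊕ t · d₀) p

    direction : Point → ℚ
    direction d = ∑[ s ∈ elements ] (𝟙[ ¬? (s ≟ᶠ 0#) ] * Eᵛ.δ (s · d₀) d)

    onℓ≡ : ∀ p → onℓ p ≡ (if ℓ p then 1ℚ else 0ℚ)
    onℓ≡ p = trans (∑-cong elements (λ t → sym (*-identityʳ _))) (∑-δ-parametrised p 1ℚ)

    direction-yes : ∀ {d s} → s ≢ 0# → s · d₀ ≡ d → direction d ≡ 1ℚ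
    direction-yes {d} {s} s≢0 s·d₀≡d = begin
      direction d                                          ≡⟨ Eᶠ.∑-supported elements-enumeration s _ others ⟩
      𝟙[ ¬? (s ≟ᶠ 0#) ] * Eᵛ.δ (s · d₀) d                  ≡⟨ cong₂ _*_ (𝟙-yes (¬? (s ≟ᶠ 0#)) s≢0) (𝟙-yes (s · d₀ ≟ᵛ d) s·d₀≡d) ⟩
      1ℚ * 1ℚ                                              ≡⟨ *-identityˡ 1ℚ ⟩
      1ℚ                                                   ∎
      where
      open ≡-Reasoning
      others : ∀ s′ → s′ ≢ s → 𝟙[ ¬? (s′ ≟ᶠ 0#) ] * Eᵛ.δ (s′ · d₀) d ≡ 0ℚ
      others s′ s′≢s = trans (cong (𝟙[ ¬? (s′ ≟ᶠ 0#) ] *_) (𝟙-no (s′ · d₀ ≟ᵛ d)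
                          (λ eq → s′≢s (·-cancelʳ-≢𝟎 d₀ d₀≢𝟎 (trans eq (sym s·d₀≡d))))))
                         (*-zeroʳ 𝟙[ ¬? (s′ ≟ᶠ 0#) ])

    direction-no : ∀ {d} → (∀ s → s ≢ 0# → s · d₀ ≢ d) → direction d ≡ 0ℚ
    direction-no {d} no-s = ∑-zero elements _ term≡0
      where
      term≡0 : ∀ s → 𝟙[ ¬? (s ≟ᶠ 0#) ] * Eᵛ.δ (s · d₀) d ≡ 0ℚ
      term≡0 s = by-cases (s ≟ᶠ 0#)
        where
        by-cases : Dec (s ≡ 0#) → 𝟙[ ¬? (s ≟ᶠ 0#) ] * Eᵛ.δ (s · d₀) d ≡ 0ℚ
        by-cases (yes s≡0) = 𝟙-no-* (¬? (s ≟ᶠ 0#)) (λ s≢0 → s≢0 s≡0) _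
        by-cases (no  s≢0) = trans (cong (𝟙[ ¬? (s ≟ᶠ 0#) ] *_) (𝟙-no (s · d₀ ≟ᵛ d) (no-s s s≢0))) (*-zeroʳ 𝟙[ ¬? (s ≟ᶠ 0#) ])

    onℓ*direction≡0 : ∀ {p d} → ¬ (d ≢ 𝟎 × line p d ≐ ℓ) → onℓ p * direction d ≡ 0ℚ
    onℓ*direction≡0 {p} {d} not-flag with ℓ p in p∈ℓ?
    ... | false = trans (cong (_* direction d) (trans (onℓ≡ p) (cong (λ b → if b then 1ℚ else 0ℚ) p∈ℓ?))) (*-zeroˡ (direction d))
    ... | true  = trans (cong (onℓ p *_) (direction-no λ s s≢0 s·d₀≡d →
                    not-flag ((λ d≡𝟎 → s·d≢𝟎 s≢0 d₀≢𝟎 (trans s·d₀≡d d≡𝟎)) , ⇒line≐ p p∈ℓ? s≢0 s·d₀≡d)))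
                        (*-zeroʳ (onℓ p))

    -- (p, d) spans ℓ iff p ∈ ℓ and d is a nonzero multiple of d₀.
    flag≡onℓ*direction : ∀ p d → 𝟙[ ¬? (d ≟ᵛ 𝟎) ] * 𝟙[ line p d ≐? ℓ ] ≡ onℓ p * direction d
    flag≡onℓ*direction p d = by-cases (d ≟ᵛ 𝟎) (line p d ≐? ℓ)
      where
      by-cases : Dec (d ≡ 𝟎) → Dec (line p d ≐ ℓ) → 𝟙[ ¬? (d ≟ᵛ 𝟎) ] * 𝟙[ line p d ≐? ℓ ] ≡ onℓ p * direction d
      by-cases (yes d≡𝟎) _ =
        trans (𝟙-no-* (¬? (d ≟ᵛ 𝟎)) (λ d≢𝟎 → d≢𝟎 d≡𝟎) _) (sym (onℓ*direction≡0 (λ (d≢𝟎 , _) → d≢𝟎 d≡𝟎)))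
      by-cases (no _) (no ¬line≐ℓ) =
        trans (cong (𝟙[ ¬? (d ≟ᵛ 𝟎) ] *_) (𝟙-no (line p d ≐? ℓ) ¬line≐ℓ)) (trans (*-zeroʳ 𝟙[ ¬? (d ≟ᵛ 𝟎) ]) (sym (onℓ*direction≡0 (λ (_ , line≐ℓ) → ¬line≐ℓ line≐ℓ))))
      by-cases (no d≢𝟎) (yes line≐ℓ) with line≐⇒ p d≢𝟎 line≐ℓ
      ... | p∈ℓ , s , s≢0 , s·d₀≡d = begin
        𝟙[ ¬? (d ≟ᵛ 𝟎) ] * 𝟙[ line p d ≐? ℓ ]   ≡⟨ cong₂ _*_ (𝟙-yes (¬? (d ≟ᵛ 𝟎)) d≢𝟎) (𝟙-yes (line p d ≐? ℓ) line≐ℓ) ⟩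
        1ℚ * 1ℚ                                  ≡⟨ sym (cong₂ _*_ (trans (onℓ≡ p) (cong (λ b → if b then 1ℚ else 0ℚ) p∈ℓ)) (direction-yes s≢0 s·d₀≡d)) ⟩
        onℓ p * direction d                      ∎
        where open ≡-Reasoning

    flag-count : ∑[ p ∈ points ] ∑[ d ∈ points ] (𝟙[ ¬? (d ≟ᵛ 𝟎) ] * 𝟙[ line p d ≐? ℓ ]) ≡ Q * (Q - 1ℚ)
    flag-count = begin
      ∑[ p ∈ points ] ∑[ d ∈ points ] (𝟙[ ¬? (d ≟ᵛ 𝟎) ] * 𝟙[ line p d ≐? ℓ ])
        ≡⟨ ∑-cong points (λ p → ∑-cong points (flag≡onℓ*direction p)) ⟩
      ∑[ p ∈ points ] ∑[ d ∈ points ] (onℓ p * direction d)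
        ≡⟨ ∑-cong points (λ p → ∑-*ˡ points (onℓ p) direction) ⟩
      ∑[ p ∈ points ] (onℓ p * ∑ points direction)
        ≡⟨ ∑-*ʳ points _ onℓ ⟩
      ∑ points onℓ * ∑ points direction
        ≡⟨ cong₂ _*_ ∑-onℓ ∑-direction ⟩
      Q * (Q - 1ℚ)
        ∎
      where
      open ≡-Reasoning
      ∑-onℓ : ∑ points onℓ ≡ Q
      ∑-onℓ = begin
        ∑[ p ∈ points ] ∑[ t ∈ elements ] Eᵛ.δ (a ⊕ t · d₀) p    ≡⟨ ∑-swap points elements _ ⟩
        ∑[ t ∈ elements ] ∑[ p ∈ points ] Eᵛ.δ (a ⊕ t · d₀) p    ≡⟨ ∑-cong elements (λ t → Eᵛ.∑-δ-1 points-enumeration (a ⊕ t · d₀)) ⟩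
        ∑ elements (λ _ → 1ℚ)                                    ≡⟨ ∑-elements-const 1ℚ ⟩
        Q * 1ℚ                                                   ≡⟨ *-identityʳ Q ⟩
        Q                                                        ∎
      ∑-direction : ∑ points direction ≡ Q - 1ℚ
      ∑-direction = begin
        ∑[ d ∈ points ] ∑[ s ∈ elements ] (𝟙[ ¬? (s ≟ᶠ 0#) ] * Eᵛ.δ (s · d₀) d)   ≡⟨ ∑-swap points elements _ ⟩
        ∑[ s ∈ elements ] ∑[ d ∈ points ] (𝟙[ ¬? (s ≟ᶠ 0#) ] * Eᵛ.δ (s · d₀) d)   ≡⟨ ∑-cong elements (λ s → ∑-*ˡ points 𝟙[ ¬? (s ≟ᶠ 0#) ] (Eᵛ.δ (s · d₀))) ⟩
        ∑[ s ∈ elements ] (𝟙[ ¬? (s ≟ᶠ 0#) ] * ∑[ d ∈ points ] Eᵛ.δ (s · d₀) d)   ≡⟨ ∑-cong elements (λ s → cong (𝟙[ ¬? (s ≟ᶠ 0#) ] *_) (Eᵛ.∑-δ-1 points-enumeration (s · d₀))) ⟩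
        ∑[ s ∈ elements ] (𝟙[ ¬? (s ≟ᶠ 0#) ] * 1ℚ)                               ≡⟨ ∑-nonzero-elements 1ℚ ⟩
        (Q - 1ℚ) * 1ℚ                                                            ≡⟨ *-identityʳ _ ⟩
        Q - 1ℚ                                                                   ∎

  sumOn-line : ∀ (c : Point → ℚ) (a : Point) {d} → d ≢ 𝟎 → sumOn c (line a d) ≡ ∑[ t ∈ elements ] c (a ⊕ t · d)
  sumOn-line c a {d} d≢𝟎 = sumOn-parametrised d≢𝟎 (line-parametrises a d) c

  ∑-points-affine : ∀ (c : Point → ℚ) p {t} → t ≢ 0# → ∑[ d ∈ points ] c (p ⊕ t · d) ≡ ∑ points c
  ∑-points-affine c p {t} t≢0 with inverse t t≢0
  ... | u , tu≡1 = Eᵛ.∑-reindex points-enumeration (λ d → p ⊕ t · d) (λ z → u · (z ⊖ p))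
                     (λ d → trans (cong (u ·_) (p⊕x⊖p≡x p (t · d))) (x·y·v≡v (trans (F.*-comm u t) tu≡1) d))
                     (λ z → trans (cong (p ⊕_) (x·y·v≡v tu≡1 (z ⊖ p))) (p⊕[z⊖p]≡z p z))
                     c

  pencilSum : (Point → ℚ) → Point → ℚ
  pencilSum c p = ∑[ d ∈ points ] (𝟙[ ¬? (d ≟ᵛ 𝟎) ] * sumOn c (line p d))

  -- Each point other than p is p + t · d for exactly q − 1 pairs with t ≠ 0 and d ≠ 𝟎.
  pencilSum-formula : ∀ c p → pencilSum c p ≡ (Qⁿ - 1ℚ) * c p + (Q - 1ℚ) * (∑ points c - c p)
  pencilSum-formula c p = begin
    pencilSum c p
      ≡⟨ ∑-cong points (λ d → 𝟙-¬-*-cong (d ≟ᵛ 𝟎) (sumOn-line c p)) ⟩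
    ∑[ d ∈ points ] (𝟙[ ¬? (d ≟ᵛ 𝟎) ] * ∑[ t ∈ elements ] c (p ⊕ t · d))
      ≡⟨ ∑-cong points (λ d → sym (∑-*ˡ elements 𝟙[ ¬? (d ≟ᵛ 𝟎) ] (λ t → c (p ⊕ t · d)))) ⟩
    ∑[ d ∈ points ] ∑[ t ∈ elements ] (𝟙[ ¬? (d ≟ᵛ 𝟎) ] * c (p ⊕ t · d))
      ≡⟨ ∑-swap points elements _ ⟩
    ∑[ t ∈ elements ] G t
      ≡⟨ Eᶠ.∑-split elements-enumeration 0# G ⟩
    G 0# + ∑[ t ∈ elements ] (𝟙[ ¬? (t ≟ᶠ 0#) ] * G t)
      ≡⟨ cong₂ _+_ G0 (∑-cong elements (λ t → 𝟙-¬-*-cong (t ≟ᶠ 0#) G≢0)) ⟩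
    (Qⁿ - 1ℚ) * c p + ∑[ t ∈ elements ] (𝟙[ ¬? (t ≟ᶠ 0#) ] * (∑ points c - c p))
      ≡⟨ cong ((Qⁿ - 1ℚ) * c p +_) (∑-nonzero-elements _) ⟩
    (Qⁿ - 1ℚ) * c p + (Q - 1ℚ) * (∑ points c - c p)
      ∎
    where
    open ≡-Reasoning
    G : Carrier → ℚ
    G t = ∑[ d ∈ points ] (𝟙[ ¬? (d ≟ᵛ 𝟎) ] * c (p ⊕ t · d))
    G0 : G 0# ≡ (Qⁿ - 1ℚ) * c p
    G0 = trans (∑-cong points (λ d → cong (λ z → 𝟙[ ¬? (d ≟ᵛ 𝟎) ] * c z) (p⊕0·d≡p p d))) (∑-nonzero-points (c p))
    G≢0 : ∀ {t} → t ≢ 0# → G t ≡ ∑ points c - c p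
    G≢0 {t} t≢0 = begin
      G t                      ≡⟨ x≡y+z⇒z≡x-y (Eᵛ.∑-split points-enumeration 𝟎 (λ d → c (p ⊕ t · d))) ⟩
      ∑[ d ∈ points ] c (p ⊕ t · d) - c (p ⊕ t · 𝟎) ≡⟨ cong₂ _-_ (∑-points-affine c p t≢0) (cong c p⊕t·𝟎≡p) ⟩
      ∑ points c - c p         ∎
      where
      p⊕t·𝟎≡p : p ⊕ t · 𝟎 ≡ p
      p⊕t·𝟎≡p = trans (cong (p ⊕_) (·-zeroʳ t)) (⊕-identityʳ p)

  -- In the plane p + ⟨e₁, e₂⟩ the q + 1 lines through p cover p q + 1 times and every other point once,
  -- while the q lines parallel to e₂ cover every point once.
  module _ (c : Point → ℚ) (p e₁ e₂ : Point) (e₂≢𝟎 : e₂ ≢ 𝟎) (e₁⊕l·e₂≢𝟎 : ∀ l → e₁ ⊕ l · e₂ ≢ 𝟎) where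

    private
      H : Carrier → ℚ
      H μ = sumOn c (line (p ⊕ μ · e₁) e₂)

      X : ℚ
      X = ∑[ t ∈ elements ] (𝟙[ ¬? (t ≟ᶠ 0#) ] * H t)

      lines-through-p : ∑[ l ∈ elements ] sumOn c (line p (e₁ ⊕ l · e₂)) ≡ Q * c p + X
      lines-through-p = begin
        ∑[ l ∈ elements ] sumOn c (line p (e₁ ⊕ l · e₂))
          ≡⟨ ∑-cong elements (λ l → sumOn-line c p (e₁⊕l·e₂≢𝟎 l)) ⟩
        ∑[ l ∈ elements ] ∑[ t ∈ elements ] c (p ⊕ t · (e₁ ⊕ l · e₂))
          ≡⟨ ∑-swap elements elements _ ⟩
        ∑[ t ∈ elements ] ∑[ l ∈ elements ] c (p ⊕ t · (e₁ ⊕ l · e₂))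
          ≡⟨ Eᶠ.∑-split elements-enumeration 0# _ ⟩
        ∑[ l ∈ elements ] c (p ⊕ 0# · (e₁ ⊕ l · e₂)) + ∑[ t ∈ elements ] (𝟙[ ¬? (t ≟ᶠ 0#) ] * ∑[ l ∈ elements ] c (p ⊕ t · (e₁ ⊕ l · e₂)))
          ≡⟨ cong₂ _+_ (trans (∑-cong elements (λ l → cong c (p⊕0·d≡p p _))) (∑-elements-const (c p)))
                       (∑-cong elements (λ t → 𝟙-¬-*-cong (t ≟ᶠ 0#) through-p⊕t·e₁)) ⟩
        Q * c p + X
          ∎
        where
        open ≡-Reasoning
        through-p⊕t·e₁ : ∀ {t} → t ≢ 0# → ∑[ l ∈ elements ] c (p ⊕ t · (e₁ ⊕ l · e₂)) ≡ H t
        through-p⊕t·e₁ {t} t≢0 with inverse t t≢0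
        ... | u , tu≡1 = begin
          ∑[ l ∈ elements ] c (p ⊕ t · (e₁ ⊕ l · e₂))       ≡⟨ ∑-cong elements (λ l → cong c (p⊕t·[e⊕l·f] p e₁ e₂ t l)) ⟩
          ∑[ l ∈ elements ] c ((p ⊕ t · e₁) ⊕ (t *ᶠ l) · e₂) ≡⟨ Eᶠ.∑-reindex elements-enumeration (t *ᶠ_) (u *ᶠ_) (x*[y*z]≡z (trans (F.*-comm u t) tu≡1)) (x*[y*z]≡z tu≡1) _ ⟩
          ∑[ l ∈ elements ] c ((p ⊕ t · e₁) ⊕ l · e₂)        ≡⟨ sym (sumOn-line c (p ⊕ t · e₁) e₂≢𝟎) ⟩
          H t                                               ∎

      parallels-to-e₂ : ∑ elements H ≡ sumOn c (line p e₂) + X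
      parallels-to-e₂ = trans (Eᶠ.∑-split elements-enumeration 0# H) (cong (λ z → sumOn c (line z e₂) + X) (p⊕0·d≡p p e₁))

    plane-identity : ∑[ l ∈ elements ] sumOn c (line p (e₁ ⊕ l · e₂)) + sumOn c (line p e₂)
                   ≡ Q * c p + ∑[ μ ∈ elements ] sumOn c (line (p ⊕ μ · e₁) e₂)
    plane-identity = begin
      ∑[ l ∈ elements ] sumOn c (line p (e₁ ⊕ l · e₂)) + sumOn c (line p e₂)   ≡⟨ cong (_+ sumOn c (line p e₂)) lines-through-p ⟩
      Q * c p + X + sumOn c (line p e₂)                                       ≡⟨ rearrange (Q * c p) X _ ⟩
      Q * c p + (sumOn c (line p e₂) + X)                                     ≡⟨ cong (Q * c p +_) (sym parallels-to-e₂) ⟩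
      Q * c p + ∑ elements H                                                  ∎
      where
      open ≡-Reasoning
      rearrange : ∀ a x y → a + x + y ≡ a + (y + x)
      rearrange = solve-∀ ℚ-ring

  module CameronLieblerClass (𝓛 : LineSet) (cl : IsCameronLiebler 𝓛) where

    c : Point → ℚ
    c = proj₁ cl

    S : ℚ
    S = ∑ points c

    private
      lines : List PointSet
      lines = LineSet.lines 𝓛

      absent : ∀ {m ℓ₀ ls} → m ≐ ℓ₀ → All.All (λ ℓ → ¬ ℓ₀ ≐ ℓ) ls → ¬ Any (m ≐_) ls
      absent m≐ℓ₀ ℓ₀-distinct = All¬⇒¬Any (All.map (λ ℓ₀≭ℓ m≐ℓ → ℓ₀≭ℓ (λ z → trans (sym (m≐ℓ₀ z)) (m≐ℓ z))) ℓ₀-distinct)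

    count-absent : ∀ m ls → ¬ Any (m ≐_) ls → ∑[ ℓ ∈ ls ] 𝟙[ m ≐? ℓ ] ≡ 0ℚ
    count-absent m []       _   = refl
    count-absent m (ℓ ∷ ls) m∉ = trans (cong₂ _+_ (𝟙-no (m ≐? ℓ) (m∉ ∘ here)) (count-absent m ls (m∉ ∘ there)))
                                       (+-identityʳ 0ℚ)

    count-present : ∀ m {ls} → AllPairs (λ ℓ ℓ′ → ¬ ℓ ≐ ℓ′) ls → Any (m ≐_) ls → ∑[ ℓ ∈ ls ] 𝟙[ m ≐? ℓ ] ≡ 1ℚ
    count-present m {ℓ₀ ∷ ls} (ℓ₀-distinct ∷ _) (here m≐ℓ₀) =
      trans (cong₂ _+_ (𝟙-yes (m ≐? ℓ₀) m≐ℓ₀) (count-absent m ls (absent m≐ℓ₀ ℓ₀-distinct))) (+-identityʳ 1ℚ)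
    count-present m {ℓ₀ ∷ ls} (ℓ₀-distinct ∷ distinct) (there m∈ls) =
      trans (cong₂ _+_ (𝟙-no (m ≐? ℓ₀) (λ m≐ℓ₀ → absent m≐ℓ₀ ℓ₀-distinct m∈ls)) (count-present m distinct m∈ls))
            (+-identityˡ 1ℚ)

    sumOn≡count : ∀ m → IsLine m → sumOn c m ≡ ∑[ ℓ ∈ lines ] 𝟙[ m ≐? ℓ ]
    sumOn≡count m m-line with Any.any? (m ≐?_) lines
    ... | yes m∈𝓛 = trans (proj₁ (proj₂ cl m m-line) m∈𝓛) (sym (count-present m (LineSet.distinct 𝓛) m∈𝓛))
    ... | no  m∉𝓛 = trans (proj₂ (proj₂ cl m m-line) m∉𝓛) (sym (count-absent m lines m∉𝓛))

    sumOn-01 : ∀ m → IsLine m → sumOn c m ≡ 0ℚ ⊎ sumOn c m ≡ 1ℚ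
    sumOn-01 m m-line with Any.any? (m ≐?_) lines
    ... | yes m∈𝓛 = inj₂ (proj₁ (proj₂ cl m m-line) m∈𝓛)
    ... | no  m∉𝓛 = inj₁ (proj₂ (proj₂ cl m m-line) m∉𝓛)

    ∑-pencilSum≡size : ∑ points (pencilSum c) ≡ ℕtoℚ (size 𝓛) * (Q * (Q - 1ℚ))
    ∑-pencilSum≡size = begin
      ∑[ p ∈ points ] ∑[ d ∈ points ] (𝟙[ ¬? (d ≟ᵛ 𝟎) ] * sumOn c (line p d))
        ≡⟨ ∑-cong points (λ p → ∑-cong points (λ d → 𝟙-¬-*-cong (d ≟ᵛ 𝟎) (λ d≢𝟎 → sumOn≡count _ (line-isLine p d≢𝟎)))) ⟩
      ∑[ p ∈ points ] ∑[ d ∈ points ] (𝟙[ ¬? (d ≟ᵛ 𝟎) ] * ∑[ ℓ ∈ lines ] 𝟙[ line p d ≐? ℓ ])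
        ≡⟨ ∑-cong points (λ p → ∑-cong points (λ d → sym (∑-*ˡ lines 𝟙[ ¬? (d ≟ᵛ 𝟎) ] (λ ℓ → 𝟙[ line p d ≐? ℓ ])))) ⟩
      ∑[ p ∈ points ] ∑[ d ∈ points ] ∑[ ℓ ∈ lines ] (𝟙[ ¬? (d ≟ᵛ 𝟎) ] * 𝟙[ line p d ≐? ℓ ])
        ≡⟨ ∑-cong points (λ p → ∑-swap points lines _) ⟩
      ∑[ p ∈ points ] ∑[ ℓ ∈ lines ] ∑[ d ∈ points ] (𝟙[ ¬? (d ≟ᵛ 𝟎) ] * 𝟙[ line p d ≐? ℓ ])
        ≡⟨ ∑-swap points lines _ ⟩
      ∑[ ℓ ∈ lines ] ∑[ p ∈ points ] ∑[ d ∈ points ] (𝟙[ ¬? (d ≟ᵛ 𝟎) ] * 𝟙[ line p d ≐? ℓ ])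
        ≡⟨ ∑-cong-All (LineSet.allLines 𝓛) (λ (_ , _ , d₀≢𝟎 , par) → flag-count d₀≢𝟎 par) ⟩
      ∑ lines (λ _ → Q * (Q - 1ℚ))
        ≡⟨ ∑-const lines _ ⟩
      ℕtoℚ (size 𝓛) * (Q * (Q - 1ℚ))
        ∎
      where open ≡-Reasoning

    ∑-pencilSum≡weight : ∑ points (pencilSum c) ≡ Q * (Qⁿ - 1ℚ) * S
    ∑-pencilSum≡weight = begin
      ∑ points (pencilSum c)
        ≡⟨ ∑-cong points (pencilSum-formula c) ⟩
      ∑[ p ∈ points ] ((Qⁿ - 1ℚ) * c p + (Q - 1ℚ) * (S - c p))
        ≡⟨ ∑-+ points _ _ ⟩
      ∑[ p ∈ points ] ((Qⁿ - 1ℚ) * c p) + ∑[ p ∈ points ] ((Q - 1ℚ) * (S - c p))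
        ≡⟨ cong₂ _+_ (∑-*ˡ points (Qⁿ - 1ℚ) c) (trans (∑-*ˡ points (Q - 1ℚ) (λ p → S - c p)) (cong ((Q - 1ℚ) *_) (∑-- points (λ _ → S) c))) ⟩
      (Qⁿ - 1ℚ) * S + (Q - 1ℚ) * (∑ points (λ _ → S) - S)
        ≡⟨ cong (λ x → (Qⁿ - 1ℚ) * S + (Q - 1ℚ) * (x - S)) (∑-points-const S) ⟩
      (Qⁿ - 1ℚ) * S + (Q - 1ℚ) * (Qⁿ * S - S)
        ≡⟨ collect Qⁿ Q S ⟩
      Q * (Qⁿ - 1ℚ) * S
        ∎
      where
      open ≡-Reasoning
      collect : ∀ N Q S → (N - 1ℚ) * S + (Q - 1ℚ) * (N * S - S) ≡ Q * (N - 1ℚ) * S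
      collect = solve-∀ ℚ-ring

    parameter≡S : 1 ℕ.≤ n → ∀ x → ℕtoℚ (size 𝓛) ≡ x * frac (q ℕ.^ n ℕ.∸ 1) (q ℕ.∸ 1) → x ≡ S
    parameter≡S 1≤n x |𝓛|≡x·F = *-cancelˡ-≡-pos (0<* Q>0 (<⇒0<- (Qⁿ>1 1≤n))) (begin
      Q * (Qⁿ - 1ℚ) * x                         ≡⟨ cong (λ y → Q * y * x) (sym F[Q-1]≡Qⁿ-1) ⟩
      Q * (F * (Q - 1ℚ)) * x                    ≡⟨ rearrange Q F x ⟩
      x * F * (Q * (Q - 1ℚ))                    ≡⟨ cong (_* (Q * (Q - 1ℚ))) (sym |𝓛|≡x·F) ⟩
      ℕtoℚ (size 𝓛) * (Q * (Q - 1ℚ))            ≡⟨ sym ∑-pencilSum≡size ⟩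
      ∑ points (pencilSum c)                    ≡⟨ ∑-pencilSum≡weight ⟩
      Q * (Qⁿ - 1ℚ) * S                         ∎)
      where
      open ≡-Reasoning
      F : ℚ
      F = frac (q ℕ.^ n ℕ.∸ 1) (q ℕ.∸ 1)
      F[Q-1]≡Qⁿ-1 : F * (Q - 1ℚ) ≡ Qⁿ - 1ℚ
      F[Q-1]≡Qⁿ-1 = begin
        F * (Q - 1ℚ)                 ≡⟨ cong (F *_) (sym (ℕtoℚ-∸ q 1 1≤q)) ⟩
        F * ℕtoℚ (q ℕ.∸ 1)           ≡⟨ frac-*-denominator _ _ (ℕ.∸-monoˡ-≤ 1 2≤q) ⟩
        ℕtoℚ (q ℕ.^ n ℕ.∸ 1)         ≡⟨ ℕtoℚ-∸ (q ℕ.^ n) 1 (ℕ.≤-trans 1≤q (q≤q^ 1≤n)) ⟩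
        Qⁿ - 1ℚ                      ∎
      rearrange : ∀ Q F x → Q * (F * (Q - 1ℚ)) * x ≡ x * F * (Q * (Q - 1ℚ))
      rearrange = solve-∀ ℚ-ring

    pencilSum-nonNeg : ∀ p → 0ℚ ≤ pencilSum c p
    pencilSum-nonNeg p = ∑-nonNeg points _ (λ d → term≥0 (d ≟ᵛ 𝟎))
      where
      term≥0 : ∀ {d} → Dec (d ≡ 𝟎) → 0ℚ ≤ 𝟙[ ¬? (d ≟ᵛ 𝟎) ] * sumOn c (line p d)
      term≥0 {d} (yes d≡𝟎) = ≤-reflexive (sym (𝟙-no-* (¬? (d ≟ᵛ 𝟎)) (λ d≢𝟎 → d≢𝟎 d≡𝟎) _))
      term≥0 {d} (no  d≢𝟎) = subst (0ℚ ≤_) (sym (𝟙-yes-* (¬? (d ≟ᵛ 𝟎)) d≢𝟎 _)) (01⇒nonNeg (sumOn-01 _ (line-isLine p d≢𝟎)))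

    pencilSum-full : ∀ p → (∀ {d} → d ≢ 𝟎 → sumOn c (line p d) ≡ 1ℚ) → pencilSum c p ≡ Qⁿ - 1ℚ
    pencilSum-full p full = trans (∑-cong points (λ d → 𝟙-¬-*-cong (d ≟ᵛ 𝟎) full))
                                  (trans (∑-nonzero-points 1ℚ) (*-identityʳ _))

    q·weight-integral : 2 ℕ.≤ n → ∀ p → ∃ λ a → ∃ λ b → Q * c p ≡ ℕtoℚ a - ℕtoℚ b
    q·weight-integral 2≤n p with independent-pair 2≤n
    ... | e₁ , e₂ , e₂≢𝟎 , e₁⊕l·e₂≢𝟎
      with ∑-01⇒ℕ elements (λ l → sumOn c (line p (e₁ ⊕ l · e₂))) (λ l → sumOn-01 _ (line-isLine p (e₁⊕l·e₂≢𝟎 l)))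
         | 01⇒ℕ (sumOn-01 _ (line-isLine p e₂≢𝟎))
         | ∑-01⇒ℕ elements (λ μ → sumOn c (line (p ⊕ μ · e₁) e₂)) (λ μ → sumOn-01 _ (line-isLine (p ⊕ μ · e₁) e₂≢𝟎))
    ... | k₁ , L₁≡k₁ | k₂ , L₂≡k₂ | k₃ , L₃≡k₃ = k₁ ℕ.+ k₂ , k₃ , x≡y+z⇒z≡x-y (begin
      ℕtoℚ (k₁ ℕ.+ k₂)       ≡⟨ ℕtoℚ-+ k₁ k₂ ⟩
      ℕtoℚ k₁ + ℕtoℚ k₂      ≡⟨ sym (cong₂ _+_ L₁≡k₁ L₂≡k₂) ⟩
      L₁ + L₂                ≡⟨ plane-identity c p e₁ e₂ e₂≢𝟎 e₁⊕l·e₂≢𝟎 ⟩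
      Q * c p + L₃           ≡⟨ +-comm (Q * c p) L₃ ⟩
      L₃ + Q * c p           ≡⟨ cong (_+ Q * c p) L₃≡k₃ ⟩
      ℕtoℚ k₃ + Q * c p      ∎)
      where
      open ≡-Reasoning
      L₁ L₂ L₃ : ℚ
      L₁ = ∑[ l ∈ elements ] sumOn c (line p (e₁ ⊕ l · e₂))
      L₂ = sumOn c (line p e₂)
      L₃ = ∑[ μ ∈ elements ] sumOn c (line (p ⊕ μ · e₁) e₂)

    module BelowBound (3≤n : 3 ℕ.≤ n)
      (S<B : S < ℕtoℚ 2 * frac (q ℕ.^ (n ℕ.∸ 1) ℕ.∸ 1) (q ℕ.^ 2 ℕ.∸ 1) + 1ℚ) where

      K : ℚ
      K = ℕtoℚ (q ℕ.^ (n ℕ.∸ 1) ℕ.∸ 1)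

      private
        q^[n-1]≥2+q : 2 ℕ.+ q ℕ.≤ q ℕ.^ (n ℕ.∸ 1)
        q^[n-1]≥2+q = 2+q≤q^ (ℕ.∸-monoˡ-≤ 1 3≤n)

      Qⁿ-1≡QK+Q-1 : Qⁿ - 1ℚ ≡ Q * K + (Q - 1ℚ)
      Qⁿ-1≡QK+Q-1 = begin
        Qⁿ - 1ℚ                                 ≡⟨ cong (λ k → ℕtoℚ (q ℕ.^ k) - 1ℚ) (sym (ℕ.suc-pred n {{ℕ.>-nonZero (ℕ.≤-trans (ℕ.s≤s ℕ.z≤n) 3≤n)}})) ⟩
        ℕtoℚ (q ℕ.* q ℕ.^ (n ℕ.∸ 1)) - 1ℚ       ≡⟨ cong (_- 1ℚ) (ℕtoℚ-* q _) ⟩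
        Q * ℕtoℚ (q ℕ.^ (n ℕ.∸ 1)) - 1ℚ         ≡⟨ split Q _ ⟩
        Q * (ℕtoℚ (q ℕ.^ (n ℕ.∸ 1)) - 1ℚ) + (Q - 1ℚ) ≡⟨ cong (λ x → Q * x + (Q - 1ℚ)) (sym (ℕtoℚ-∸ _ 1 (ℕ.≤-trans (ℕ.s≤s ℕ.z≤n) q^[n-1]≥2+q))) ⟩
        Q * K + (Q - 1ℚ)                        ∎
        where
        open ≡-Reasoning
        split : ∀ Q P → Q * P - 1ℚ ≡ Q * (P - 1ℚ) + (Q - 1ℚ)
        split = solve-∀ ℚ-ring

      Q+1≤K : Q + 1ℚ ≤ K
      Q+1≤K = subst (_≤ K) (trans (ℕtoℚ-suc q) (+-comm 1ℚ Q)) (ℕtoℚ-mono-≤ (ℕ.∸-monoˡ-≤ 1 q^[n-1]≥2+q))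

      K>0 : 0ℚ < K
      K>0 = <-≤-trans (+-mono-<-≤ Q>0 (nonNegative⁻¹ 1ℚ)) Q+1≤K

      F : ℚ
      F = frac (q ℕ.^ (n ℕ.∸ 1) ℕ.∸ 1) (q ℕ.^ 2 ℕ.∸ 1)

      F[Q²-1]≡K : F * (Q * Q - 1ℚ) ≡ K
      F[Q²-1]≡K = begin
        F * (Q * Q - 1ℚ)              ≡⟨ cong (F *_) (sym Q²-1) ⟩
        F * ℕtoℚ (q ℕ.^ 2 ℕ.∸ 1)      ≡⟨ frac-*-denominator (q ℕ.^ (n ℕ.∸ 1) ℕ.∸ 1) (q ℕ.^ 2 ℕ.∸ 1) (ℕ.∸-monoˡ-≤ 1 q²≥2) ⟩
        K                             ∎
        where
        open ≡-Reasoning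
        q²≥2 : 2 ℕ.≤ q ℕ.^ 2
        q²≥2 = ℕ.≤-trans (ℕ.m≤m+n 2 q) (2+q≤q^ ℕ.≤-refl)
        Q²-1 : ℕtoℚ (q ℕ.^ 2 ℕ.∸ 1) ≡ Q * Q - 1ℚ
        Q²-1 = trans (ℕtoℚ-∸ (q ℕ.^ 2) 1 (ℕ.≤-trans (ℕ.s≤s ℕ.z≤n) q²≥2))
                     (cong (_- 1ℚ) (trans (ℕtoℚ-* q (q ℕ.* 1)) (cong (λ m → Q * ℕtoℚ m) (ℕ.*-identityʳ q))))

      gap : 0ℚ < K - (Q - 1ℚ) * S
      gap = 0<*-cancelˡ Q+1>0 (subst (0ℚ <_) factorise sum>0)
        where
        open ≡-Reasoning
        Q+1>0 : 0ℚ < Q + 1ℚ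
        Q+1>0 = +-mono-<-≤ Q>0 (nonNegative⁻¹ 1ℚ)
        Q²-1>0 : 0ℚ < Q * Q - 1ℚ
        Q²-1>0 = subst (0ℚ <_) (difference-of-squares Q) (0<* (<⇒0<- Q>1) Q+1>0)
          where
          difference-of-squares : ∀ Q → (Q - 1ℚ) * (Q + 1ℚ) ≡ Q * Q - 1ℚ
          difference-of-squares = solve-∀ ℚ-ring
        sum>0 : 0ℚ < (Q * Q - 1ℚ) * (ℕtoℚ 2 * F + 1ℚ - S) + (Q - 1ℚ) * (K - (Q + 1ℚ))
        sum>0 = +-mono-<-≤ (0<* Q²-1>0 (<⇒0<- S<B)) (0≤* (<⇒≤ (<⇒0<- Q>1)) (≤⇒0≤- Q+1≤K))
        factorise : (Q * Q - 1ℚ) * (ℕtoℚ 2 * F + 1ℚ - S) + (Q - 1ℚ) * (K - (Q + 1ℚ)) ≡ (Q + 1ℚ) * (K - (Q - 1ℚ) * S)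
        factorise = begin
          (Q * Q - 1ℚ) * (ℕtoℚ 2 * F + 1ℚ - S) + (Q - 1ℚ) * (K - (Q + 1ℚ))
            ≡⟨ cong (λ k → (Q * Q - 1ℚ) * (ℕtoℚ 2 * F + 1ℚ - S) + (Q - 1ℚ) * (k - (Q + 1ℚ))) (sym F[Q²-1]≡K) ⟩
          (Q * Q - 1ℚ) * (ℕtoℚ 2 * F + 1ℚ - S) + (Q - 1ℚ) * (F * (Q * Q - 1ℚ) - (Q + 1ℚ))
            ≡⟨ identity Q F S ⟩
          (Q + 1ℚ) * (F * (Q * Q - 1ℚ) - (Q - 1ℚ) * S)
            ≡⟨ cong (λ k → (Q + 1ℚ) * (k - (Q - 1ℚ) * S)) F[Q²-1]≡K ⟩
          (Q + 1ℚ) * (K - (Q - 1ℚ) * S)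
            ∎
          where
          identity : ∀ Q F S → (Q * Q - 1ℚ) * (ℕtoℚ 2 * F + 1ℚ - S) + (Q - 1ℚ) * (F * (Q * Q - 1ℚ) - (Q + 1ℚ))
                             ≡ (Q + 1ℚ) * (F * (Q * Q - 1ℚ) - (Q - 1ℚ) * S)
          identity = solve-∀ ℚ-ring

      pencilSum≡ : ∀ p → pencilSum c p ≡ Q * K * c p + (Q - 1ℚ) * S
      pencilSum≡ p = begin
        pencilSum c p                                       ≡⟨ pencilSum-formula c p ⟩
        (Qⁿ - 1ℚ) * c p + (Q - 1ℚ) * (S - c p)              ≡⟨ cong (λ x → x * c p + (Q - 1ℚ) * (S - c p)) Qⁿ-1≡QK+Q-1 ⟩
        (Q * K + (Q - 1ℚ)) * c p + (Q - 1ℚ) * (S - c p)     ≡⟨ simplify Q K (c p) S ⟩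
        Q * K * c p + (Q - 1ℚ) * S                          ∎
        where
        open ≡-Reasoning
        simplify : ∀ Q K γ S → (Q * K + (Q - 1ℚ)) * γ + (Q - 1ℚ) * (S - γ) ≡ Q * K * γ + (Q - 1ℚ) * S
        simplify = solve-∀ ℚ-ring

      weight-nonNeg : ∀ p → 0ℚ ≤ c p
      weight-nonNeg p = from-integral (q·weight-integral (ℕ.≤-trans (ℕ.n≤1+n 2) 3≤n) p)
        where
        K[Qc+1]>0 : 0ℚ < K * (Q * c p + 1ℚ)
        K[Qc+1]>0 = subst (0ℚ <_) (trans (cong (K - (Q - 1ℚ) * S +_) (pencilSum≡ p)) (collect K Q S (c p)))
                          (+-mono-<-≤ gap (pencilSum-nonNeg p))
          where
          collect : ∀ K Q S γ → K - (Q - 1ℚ) * S + (Q * K * γ + (Q - 1ℚ) * S) ≡ K * (Q * γ + 1ℚ)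
          collect = solve-∀ ℚ-ring
        from-integral : (∃ λ a → ∃ λ b → Q * c p ≡ ℕtoℚ a - ℕtoℚ b) → 0ℚ ≤ c p
        from-integral (a , b , Qc≡a-b) =
          0≤*-cancelˡ Q>0 (ℕ-difference>-1⇒nonNeg a b Qc≡a-b (0<*-cancelˡ K>0 K[Qc+1]>0))

      weight≤sumOn-line : ∀ p {d} → d ≢ 𝟎 → c p ≤ sumOn c (line p d)
      weight≤sumOn-line p {d} d≢𝟎 = begin
        c p                               ≡⟨ cong c (sym (p⊕0·d≡p p d)) ⟩
        c (p ⊕ 0# · d)                    ≤⟨ Eᶠ.≤-∑ elements-enumeration (λ t → c (p ⊕ t · d)) 0# (λ t → weight-nonNeg _) ⟩
        ∑[ t ∈ elements ] c (p ⊕ t · d)   ≡⟨ sym (sumOn-line c p d≢𝟎) ⟩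
        sumOn c (line p d)                ∎
        where open ≤-Reasoning

      support-full : ∀ {p} → 0ℚ < c p → ∀ {d} → d ≢ 𝟎 → sumOn c (line p d) ≡ 1ℚ
      support-full {p} c>0 {d} d≢𝟎 = from-01 (sumOn-01 _ (line-isLine p d≢𝟎))
        where
        from-01 : sumOn c (line p d) ≡ 0ℚ ⊎ sumOn c (line p d) ≡ 1ℚ → sumOn c (line p d) ≡ 1ℚ
        from-01 (inj₂ sum≡1) = sum≡1
        from-01 (inj₁ sum≡0) = ⊥-elim (<-irrefl refl (<-≤-trans c>0 (subst (c p ≤_) sum≡0 (weight≤sumOn-line p d≢𝟎))))

      support-equation : ∀ {p} → 0ℚ < c p → Q * K * (1ℚ - c p) ≡ (Q - 1ℚ) * (S - 1ℚ)
      support-equation {p} c>0 = a*γ+b*s≡a+b⇒a*[1-γ]≡b*[s-1] {Q * K} {Q - 1ℚ} {c p} {S} (begin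
        Q * K * c p + (Q - 1ℚ) * S         ≡⟨ sym (pencilSum≡ p) ⟩
        pencilSum c p                      ≡⟨ pencilSum-full p (support-full c>0) ⟩
        Qⁿ - 1ℚ                            ≡⟨ Qⁿ-1≡QK+Q-1 ⟩
        Q * K + (Q - 1ℚ)                   ∎)
        where open ≡-Reasoning

      support-constant : ∀ {p z} → 0ℚ < c p → 0ℚ < c z → c z ≡ c p
      support-constant c[p]>0 c[z]>0 = 1-x≡1-y⇒x≡y (*-cancelˡ-≡-pos (0<* Q>0 K>0)
        (trans (support-equation c[z]>0) (sym (support-equation c[p]>0))))

      support-weight>½ : ∀ {p} → 0ℚ < c p → 1ℚ < c p + c p
      support-weight>½ {p} c>0 = 0<-⇒< (0<*-cancelˡ (0<* Q>0 K>0) (subst (0ℚ <_) (sym QK[2γ-1]≡sum) sum>0))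
        where
        open ≡-Reasoning
        G E : ℚ
        G = K - (Q - 1ℚ) * S
        E = (Q - 1ℚ) * (S - 1ℚ)
        sum>0 : 0ℚ < (Q - ℕtoℚ 2) * K + (G + G) + ((Q - 1ℚ) + (Q - 1ℚ))
        sum>0 = +-mono-<-≤ (+-mono-≤-< (0≤* (≤⇒0≤- (ℕtoℚ-mono-≤ 2≤q)) (<⇒≤ K>0)) (+-mono-<-≤ gap (<⇒≤ gap)))
                           (+-mono-≤ Q-1≥0 Q-1≥0)
          where
          Q-1≥0 : 0ℚ ≤ Q - 1ℚ
          Q-1≥0 = <⇒≤ (<⇒0<- Q>1)
        QK[2γ-1]≡sum : Q * K * (c p + c p - 1ℚ) ≡ (Q - ℕtoℚ 2) * K + (G + G) + ((Q - 1ℚ) + (Q - 1ℚ))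
        QK[2γ-1]≡sum = begin
          Q * K * (c p + c p - 1ℚ)
            ≡⟨ identity Q K S (c p) ⟩
          (Q - ℕtoℚ 2) * K + (G + G) + ((Q - 1ℚ) + (Q - 1ℚ)) + ((E - Q * K * (1ℚ - c p)) + (E - Q * K * (1ℚ - c p)))
            ≡⟨ cong (λ x → (Q - ℕtoℚ 2) * K + (G + G) + ((Q - 1ℚ) + (Q - 1ℚ)) + ((E - x) + (E - x))) (support-equation c>0) ⟩
          (Q - ℕtoℚ 2) * K + (G + G) + ((Q - 1ℚ) + (Q - 1ℚ)) + ((E - E) + (E - E))
            ≡⟨ cong (λ x → (Q - ℕtoℚ 2) * K + (G + G) + ((Q - 1ℚ) + (Q - 1ℚ)) + (x + x)) (+-inverseʳ E) ⟩
          (Q - ℕtoℚ 2) * K + (G + G) + ((Q - 1ℚ) + (Q - 1ℚ)) + 0ℚ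
            ≡⟨ +-identityʳ _ ⟩
          (Q - ℕtoℚ 2) * K + (G + G) + ((Q - 1ℚ) + (Q - 1ℚ))
            ∎
          where
          identity : ∀ Q K S γ → Q * K * (γ + γ - 1ℚ)
                     ≡ (Q - ℕtoℚ 2) * K + ((K - (Q - 1ℚ) * S) + (K - (Q - 1ℚ) * S)) + ((Q - 1ℚ) + (Q - 1ℚ))
                       + (((Q - 1ℚ) * (S - 1ℚ) - Q * K * (1ℚ - γ)) + ((Q - 1ℚ) * (S - 1ℚ) - Q * K * (1ℚ - γ)))
          identity = solve-∀ ℚ-ring

      rest : Point → Point → ℚ
      rest p d = ∑[ t ∈ elements ] (𝟙[ ¬? (t ≟ᶠ 0#) ] * c (p ⊕ t · d))

      rest-term-nonNeg : ∀ p d t → 0ℚ ≤ 𝟙[ ¬? (t ≟ᶠ 0#) ] * c (p ⊕ t · d)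
      rest-term-nonNeg p d t = 0≤* (01⇒nonNeg (𝟙-01 (¬? (t ≟ᶠ 0#)))) (weight-nonNeg _)

      sumOn-line≡weight+rest : ∀ p {d} → d ≢ 𝟎 → sumOn c (line p d) ≡ c p + rest p d
      sumOn-line≡weight+rest p {d} d≢𝟎 = begin
        sumOn c (line p d)                   ≡⟨ sumOn-line c p d≢𝟎 ⟩
        ∑[ t ∈ elements ] c (p ⊕ t · d)      ≡⟨ Eᶠ.∑-split elements-enumeration 0# (λ t → c (p ⊕ t · d)) ⟩
        c (p ⊕ 0# · d) + rest p d            ≡⟨ cong (λ z → c z + rest p d) (p⊕0·d≡p p d) ⟩
        c p + rest p d                       ∎
        where open ≡-Reasoning

      support-in-rest : ∀ p d → 0ℚ < rest p d → ∃ λ z → 0ℚ < c z × c z ≤ rest p d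
      support-in-rest p d rest>0 = from-positive-term (∑-pos⇒∃ elements _ rest>0)
        where
        from-positive-term : (∃ λ t → 0ℚ < 𝟙[ ¬? (t ≟ᶠ 0#) ] * c (p ⊕ t · d)) → ∃ λ z → 0ℚ < c z × c z ≤ rest p d
        from-positive-term (t , term>0) = from-term (t ≟ᶠ 0#)
          where
          term≤rest : 𝟙[ ¬? (t ≟ᶠ 0#) ] * c (p ⊕ t · d) ≤ rest p d
          term≤rest = Eᶠ.≤-∑ elements-enumeration _ t (rest-term-nonNeg p d)
          from-term : Dec (t ≡ 0#) → ∃ λ z → 0ℚ < c z × c z ≤ rest p d
          from-term (yes t≡0) = ⊥-elim (<-irrefl (sym (𝟙-no-* (¬? (t ≟ᶠ 0#)) (λ t≢0 → t≢0 t≡0) _)) term>0)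
          from-term (no  t≢0) = p ⊕ t · d , subst (0ℚ <_) term≡c term>0 , subst (_≤ rest p d) term≡c term≤rest
            where
            term≡c : 𝟙[ ¬? (t ≟ᶠ 0#) ] * c (p ⊕ t · d) ≡ c (p ⊕ t · d)
            term≡c = 𝟙-yes-* (¬? (t ≟ᶠ 0#)) t≢0 _

      -- A line of 𝓛 through p has weight 1; were p its only point of positive weight, c p = 1 and S = 1.
      support-weight≤½ : ∀ {p} → 0ℚ < c p → S ≢ 1ℚ → c p + c p ≤ 1ℚ
      support-weight≤½ {p} c>0 S≢1 = from-rest (rest p e ≟ 0ℚ)
        where
        e : Point
        e = proj₁ (proj₂ (independent-pair (ℕ.≤-trans (ℕ.n≤1+n 2) 3≤n)))
        e≢𝟎 : e ≢ 𝟎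
        e≢𝟎 = proj₁ (proj₂ (proj₂ (independent-pair (ℕ.≤-trans (ℕ.n≤1+n 2) 3≤n))))
        1≡c+rest : c p + rest p e ≡ 1ℚ
        1≡c+rest = trans (sym (sumOn-line≡weight+rest p e≢𝟎)) (support-full c>0 e≢𝟎)
        from-rest : Dec (rest p e ≡ 0ℚ) → c p + c p ≤ 1ℚ
        from-rest (yes rest≡0) = ⊥-elim (S≢1 (x-1≡0⇒x≡1 (*-cancelˡ-≡-pos (<⇒0<- Q>1) (begin
          (Q - 1ℚ) * (S - 1ℚ)     ≡⟨ sym (support-equation c>0) ⟩
          Q * K * (1ℚ - c p)      ≡⟨ cong (λ x → Q * K * (1ℚ - x)) c≡1 ⟩
          Q * K * (1ℚ - 1ℚ)       ≡⟨ trans (cong (Q * K *_) (+-inverseʳ 1ℚ)) (*-zeroʳ (Q * K)) ⟩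
          0ℚ                      ≡⟨ sym (*-zeroʳ (Q - 1ℚ)) ⟩
          (Q - 1ℚ) * 0ℚ           ∎))))
          where
          open ≡-Reasoning
          c≡1 : c p ≡ 1ℚ
          c≡1 = trans (sym (+-identityʳ (c p))) (trans (cong (c p +_) (sym rest≡0)) 1≡c+rest)
        from-rest (no rest≢0) = from-support (support-in-rest p e (nonNeg∧≢0⇒pos (∑-nonNeg elements _ (rest-term-nonNeg p e)) rest≢0))
          where
          from-support : (∃ λ z → 0ℚ < c z × c z ≤ rest p e) → c p + c p ≤ 1ℚ
          from-support (z , c[z]>0 , c[z]≤rest) = begin
            c p + c p               ≡⟨ cong (c p +_) (sym (support-constant c>0 c[z]>0)) ⟩
            c p + c z               ≤⟨ +-monoʳ-≤ (c p) c[z]≤rest ⟩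
            c p + rest p e          ≡⟨ 1≡c+rest ⟩
            1ℚ                      ∎
            where open ≤-Reasoning

      S≡0⊎S≡1 : S ≡ 0ℚ ⊎ S ≡ 1ℚ
      S≡0⊎S≡1 = by-cases (S ≟ 0ℚ) (S ≟ 1ℚ)
        where
        by-cases : Dec (S ≡ 0ℚ) → Dec (S ≡ 1ℚ) → S ≡ 0ℚ ⊎ S ≡ 1ℚ
        by-cases (yes S≡0) _         = inj₁ S≡0
        by-cases _         (yes S≡1) = inj₂ S≡1
        by-cases (no S≢0)  (no S≢1)  =
          ⊥-elim (support-point-absurd (∑-pos⇒∃ points c (nonNeg∧≢0⇒pos (∑-nonNeg points c weight-nonNeg) S≢0)))
          where
          support-point-absurd : (∃ λ p → 0ℚ < c p) → ⊥
          support-point-absurd (p , c>0) = <-irrefl refl (<-≤-trans (support-weight>½ c>0) (support-weight≤½ c>0 S≢1))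

theorem9p2 : (q : ℕ) (𝔽 : FiniteField q) (n : ℕ) → 4 ℕ.≤ n →
    (𝓛 : AG.LineSet 𝔽 n) → AG.IsCameronLiebler 𝔽 n 𝓛 →
    (x : ℚ) → ℕtoℚ (AG.size 𝔽 n 𝓛) ≡ x * frac (q ℕ.^ n ℕ.∸ 1) (q ℕ.∸ 1) →
    x ≡ 0ℚ ⊎ x ≡ 1ℚ ⊎ (ℕtoℚ 2 * frac (q ℕ.^ (n ℕ.∸ 1) ℕ.∸ 1) (q ℕ.^ 2 ℕ.∸ 1) + 1ℚ) ≤ x
theorem9p2 q 𝔽 n 4≤n 𝓛 cl x |𝓛|≡x·F = by-cases (B ≤? x)
  where
  open AffineGeometry.CameronLieblerClass 𝔽 n 𝓛 cl using (S; parameter≡S; module BelowBound)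
  B : ℚ
  B = ℕtoℚ 2 * frac (q ℕ.^ (n ℕ.∸ 1) ℕ.∸ 1) (q ℕ.^ 2 ℕ.∸ 1) + 1ℚ
  x≡S : x ≡ S
  x≡S = parameter≡S (ℕ.≤-trans (ℕ.s≤s ℕ.z≤n) 4≤n) x |𝓛|≡x·F
  by-cases : Dec (B ≤ x) → x ≡ 0ℚ ⊎ x ≡ 1ℚ ⊎ B ≤ x
  by-cases (yes B≤x) = inj₂ (inj₂ B≤x)
  by-cases (no  B≰x) = Sum.map (trans x≡S) (inj₁ ∘ trans x≡S)
    (BelowBound.S≡0⊎S≡1 (ℕ.≤-trans (ℕ.n≤1+n 3) 4≤n) (subst (_< B) x≡S (≰⇒> B≰x)))
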